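{- Let $n\ge 2$ and let $f$ be a linear space function on $\{1,\dots,n\}$ having a point of index $0$, $1$, or $2$. Then there are polynomials $p_0(q)$ and $p_g(q)$ (one for each linear space function $g$ on $\{1,\dots,n-1\}$), depending only on $f$ and $g$ and not on the plane, such that for every finite projective plane $\Pi$ of order $q$, \[ B_f(\Pi)=p_0(q)+\sum_{g} p_g(q)\,A_g(\Pi), \] the sum ranging over linear space functions $g$ on $n-1$ points. In particular $B_f(\Pi)$ is a polynomial in $q$ and the values $A_g(\Pi)$, linear in the $A_g(\Pi)$.
   Context: A projective plane of order $q$: a set of points with lines (subsets) such that two distinct points lie on a unique line, two distinct lines meet in a unique point, there are four points no three collinear, every line has $q+1$ points and every point lies on $q+1$ lines. A boolean $n$-function is a function from subsets of $\{1,\dots,n\}$ to $\{0,1\}$; for boolean $n$-functions, $f\ge g$ means $f(S)\ge g(S)$ for all $S$. A boolean $n$-function $f$ is a linear space function if: (1) $f(I)=1$ implies $f(J)=1$ for all $J\subseteq I$; (2) $f(I)=1$ whenever $\#I\le 2$; (3) if $f(I)=f(J)=1$ and $\#(I\cap J)\ge2$ then $f(I\cup J)=1$. A full line of a linear space function $f$ is a set $S$ with $\#S\ge3$, $f(S)=1$, and $f(T)=0$ for every $T\supsetneq S$; the index of a point $p$ is the number of full lines of $f$ containing $p$. A strong realization of a boolean $n$-function $f$ in $\Pi$ is an $n$-tuple of distinct points of $\Pi$, labeled $1,\dots,n$, such that $f^{ -1}(1)$ is exactly the collection of (label sets of) collinear subsets of the tuple; $A_f(\Pi)$ is the number of strong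 realizations. $B_f(\Pi)=\sum_{g\ge f}A_g(\Pi)$, the sum over all boolean $n$-functions $g\ge f$ (for $f$ a linear space function this is the number of $n$-tuples of distinct points in which every set $I$ with $f(I)=1$ is collinear). -}

module Defs where

open import Data.Nat using (ℕ; zero; suc; _≤ᵇ_)
open import Data.Bool using (Bool; true; false; _∧_; _∨_; not; if_then_else_)
open import Data.List using (List; []; _∷_; [_]; concatMap; map; length; allFin; foldr)
open import Data.Bool.ListAction using (all; any)
open import Data.Nat.ListAction using (sum)
open import Data.Fin using (Fin; zero; suc)
import Data.Fin as F
open import Data.Fin.Subset using (Subset; outside; inside; ∣_∣; _∩_; _∪_)
open import Data.Vec using (Vec; []; _∷_; lookup)
open import Data.Integer using (ℤ) renaming (_+_ to _+ℤ_; _*_ to _*ℤ_)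
import Data.Integer as Z
open import Data.Product using (Σ; ∃-syntax; _×_; _,_)
open import Relation.Binary.PropositionalEquality using (_≡_; _≢_)
open import Relation.Nullary using (¬_)
open import Relation.Nullary.Decidable using (⌊_⌋)
import Data.Bool as B

filterᵇ : ∀ {A : Set} → (A → Bool) → List A → List A
filterᵇ p [] = []
filterᵇ p (x ∷ xs) = if p x then x ∷ filterᵇ p xs else filterᵇ p xs

allSubsets : (n : ℕ) → List (Subset n)
allSubsets zero = [ [] ]
allSubsets (suc n) = concatMap (λ s → (outside ∷ s) ∷ (inside ∷ s) ∷ []) (allSubsets n)

_≡ˢ_ : ∀ {n} → Subset n → Subset n → Bool
[] ≡ˢ [] = true
(a ∷ s) ≡ˢ (b ∷ t) = ⌊ a B.≟ b ⌋ ∧ (s ≡ˢ t)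

_⊆ˢ_ : ∀ {n} → Subset n → Subset n → Bool
[] ⊆ˢ [] = true
(a ∷ s) ⊆ˢ (b ∷ t) = (not a ∨ b) ∧ (s ⊆ˢ t)

_⊂ˢ_ : ∀ {n} → Subset n → Subset n → Bool
s ⊂ˢ t = (s ⊆ˢ t) ∧ not (s ≡ˢ t)

BoolFun : ℕ → Set
BoolFun n = Subset n → Bool

-- all functions from the (duplicate-free) domain list to Bool, each
-- exactly once (values outside the list are false)
funsOn : ∀ {n} → List (Subset n) → List (BoolFun n)
funsOn [] = [ (λ _ → false) ]
funsOn (x ∷ xs) = concatMap
  (λ g → (λ y → if y ≡ˢ x then false else g y) ∷ (λ y → if y ≡ˢ x then true else g y) ∷ [])
  (funsOn xs)

allBoolFuns : (n : ℕ) → List (BoolFun n)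
allBoolFuns n = funsOn (allSubsets n)

_≤ᶠ_ : ∀ {n} → BoolFun n → BoolFun n → Bool
_≤ᶠ_ {n} f g = all (λ S → not (f S) ∨ g S) (allSubsets n)

isLSF : ∀ {n} → BoolFun n → Bool
isLSF {n} f = all (λ I → all (λ J →
      (not ((J ⊆ˢ I) ∧ f I) ∨ f J)
    ∧ (not (∣ I ∣ ≤ᵇ 2) ∨ f I)
    ∧ (not (f I ∧ f J ∧ (2 ≤ᵇ ∣ I ∩ J ∣)) ∨ f (I ∪ J)))
  (allSubsets n)) (allSubsets n)

isFullLine : ∀ {n} → BoolFun n → Subset n → Bool
isFullLine {n} f S = (3 ≤ᵇ ∣ S ∣) ∧ f S ∧ all (λ T → not (S ⊂ˢ T) ∨ not (f T)) (allSubsets n)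

index : ∀ {n} → BoolFun n → Fin n → ℕ
index {n} f p = length (filterᵇ (λ S → isFullLine f S ∧ lookup S p) (allSubsets n))

record ProjectivePlane (q : ℕ) : Set where
  field
    nPoints nLines : ℕ
    incident : Fin nPoints → Fin nLines → Bool
    lineThrough : ∀ x y → x ≢ y → ∃[ ℓ ] (incident x ℓ ≡ true × incident y ℓ ≡ true
                    × (∀ ℓ′ → incident x ℓ′ ≡ true → incident y ℓ′ ≡ true → ℓ′ ≡ ℓ))
    meetPoint : ∀ ℓ m → ℓ ≢ m → ∃[ x ] (incident x ℓ ≡ true × incident x m ≡ true
                    × (∀ x′ → incident x′ ℓ ≡ true → incident x′ m ≡ true → x′ ≡ x))
    quadrangle : Σ (Fin 4 → Fin nPoints) λ v → (∀ i j → v i ≡ v j → i ≡ j)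
                    × (∀ i j k → i ≢ j → j ≢ k → i ≢ k → ∀ ℓ →
                        ¬ (incident (v i) ℓ ≡ true × incident (v j) ℓ ≡ true × incident (v k) ℓ ≡ true))
    linePoints : ∀ ℓ → length (filterᵇ (λ x → incident x ℓ) (allFin nPoints)) ≡ suc q
    pointLines : ∀ x → length (filterᵇ (λ ℓ → incident x ℓ) (allFin nLines)) ≡ suc q

open ProjectivePlane public

allMaps : (n N : ℕ) → List (Fin n → Fin N)
allMaps zero N = [ (λ ()) ]
allMaps (suc n) N = concatMap (λ x → map (λ t → λ { zero → x ; (suc i) → t i }) (allMaps n N)) (allFin N)

module _ {q : ℕ} (Π : ProjectivePlane q) where

  distinctᵇ : ∀ {n} → (Fin n → Fin (nPoints Π)) → Bool
  distinctᵇ {n} t = all (λ i → all (λ j → ⌊ i F.≟ j ⌋ ∨ not ⌊ t i F.≟ t j ⌋) (allFin n)) (allFin n)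

  collinearᵇ : ∀ {n} → (Fin n → Fin (nPoints Π)) → Subset n → Bool
  collinearᵇ {n} t S = any (λ ℓ → all (λ i → not (lookup S i) ∨ incident Π (t i) ℓ) (allFin n)) (allFin (nLines Π))

  strongRealizationᵇ : ∀ {n} → BoolFun n → (Fin n → Fin (nPoints Π)) → Bool
  strongRealizationᵇ {n} f t = distinctᵇ t ∧ all (λ S → ⌊ f S B.≟ collinearᵇ t S ⌋) (allSubsets n)

  A : ∀ {n} → BoolFun n → ℕ
  A {n} f = length (filterᵇ (strongRealizationᵇ f) (allMaps n (nPoints Π)))

  B : ∀ {n} → BoolFun n → ℕ
  B {n} f = sum (map A (filterᵇ (λ g → f ≤ᶠ g) (allBoolFuns n)))

-- Integer polynomials (coefficient lists, constant term first)

Poly : Set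
Poly = List ℤ

eval : Poly → ℤ → ℤ
eval [] x = Z.0ℤ
eval (c ∷ cs) x = c +ℤ (x *ℤ eval cs x)

sumℤ : List ℤ → ℤ
sumℤ = foldr _+ℤ_ Z.0ℤ

-- Delete a point p of index at most 2. A tuple counted by B_f (n distinct points whose collinear
-- label sets include those of f) is a tuple s of n − 1 distinct points, whose collinearity function g
-- is a linear space function with g ≥ f restricted to the other labels, together with a new point x
-- at position p such that every full line of f through p stays collinear. The number of such x
-- depends only on g and q: with no full line through p it is q² + q + 1 − (n − 1); with one, x must
-- lie on the line spanned by the rest of that full line, leaving q + 1 minus the points of s on it;
-- with two, x lies on both spanned lines, which either coincide (as before) or meet in a single
-- point that is admissible exactly when it is not a point of s. Grouping the tuples s by g gives
-- B_f = Σ_g p_g(q) A_g, with p₀ = 0.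

module Submission where

open import Defs
open import Data.Nat using (ℕ; zero; suc; z≤n; s≤s; _≤_; _<_; _∸_; _≤ᵇ_)
import Data.Nat as ℕ
import Data.Nat.Properties as ℕₚ
open import Data.Nat.ListAction using (sum)
open import Data.Bool using (Bool; true; false; not; _∧_; _∨_; if_then_else_; T)
import Data.Bool as Bool
import Data.Bool.Properties as Boolₚ
open import Data.Bool.ListAction using (all; any)
open import Data.List using (List; []; _∷_; _++_; length; concatMap; allFin; map)
import Data.List.Properties as Listₚ
open import Data.List.Membership.Propositional using (_∈_)
open import Data.List.Membership.Propositional.Properties using (∈-allFin)
open import Data.List.Relation.Unary.Any using (here; there)
open import Data.List.Relation.Unary.All using (All; []; _∷_)
open import Data.List.Relation.Unary.All.Properties using (¬Any⇒All¬; All¬⇒¬Any)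
open import Data.List.Relation.Unary.AllPairs using ([]; _∷_)
open import Data.List.Relation.Unary.Unique.Propositional using (Unique)
open import Data.Fin using (Fin; zero; suc; punchIn; punchOut)
import Data.Fin as Fin
import Data.Fin.Properties as Finₚ
open import Data.Fin.Subset using (Subset; outside; inside; ∣_∣; _∩_; _∪_)
open import Data.Fin.Subset.Properties using (∣p∣≤n)
open import Data.Vec using (Vec; lookup; removeAt; _[_]≔_)
import Data.Vec as Vec
import Data.Vec.Properties as Vecₚ
open import Data.Integer using (ℤ; +_; _+_; _*_; _-_)
import Data.Integer.Properties as ℤₚ
open import Data.Integer.Tactic.RingSolver using (solve-∀)
open import Data.Product using (Σ; ∃-syntax; _×_; _,_; proj₁; proj₂)
open import Data.Sum using (_⊎_; inj₁; inj₂; [_,_]; map₂)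
open import Data.Empty using (⊥-elim)
open import Data.Vec.Functional using (insertAt) renaming (_∷_ to _∷ᶠ_)
import Data.Vec.Functional.Properties as Functionalₚ
open import Function using (_∘_)
open import Function.Definitions using (Injective)
open import Relation.Binary.PropositionalEquality
  using (_≡_; _≢_; _≗_; refl; sym; trans; cong; cong₂; subst; module ≡-Reasoning)
open import Relation.Nullary using (Dec; yes; no)
open import Relation.Nullary.Decidable using (⌊_⌋)

cong₃ : ∀ {A B C D : Set} (F : A → B → C → D) {a a′ b b′ c c′} →
  a ≡ a′ → b ≡ b′ → c ≡ c′ → F a b c ≡ F a′ b′ c′
cong₃ F refl refl refl = refl

true≢false : true ≢ false
true≢false ()

∧-trueˡ : ∀ {a b} → a ∧ b ≡ true → a ≡ true
∧-trueˡ {true} _ = refl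

∧-trueʳ : ∀ {a b} → a ∧ b ≡ true → b ≡ true
∧-trueʳ {true} e = e

∧-true : ∀ {a b} → a ≡ true → b ≡ true → a ∧ b ≡ true
∧-true refl refl = refl

not-∨-intro : ∀ {a b} → (a ≡ true → b ≡ true) → not a ∨ b ≡ true
not-∨-intro {false} _ = refl
not-∨-intro {true} h = h refl

not-∨-elim : ∀ {a b} → not a ∨ b ≡ true → a ≡ true → b ≡ true
not-∨-elim {true} e refl = e

not≡true⇒≡false : ∀ {a} → not a ≡ true → a ≡ false
not≡true⇒≡false {false} _ = refl

≡false⇒not≡true : ∀ {a} → a ≡ false → not a ≡ true
≡false⇒not≡true refl = refl

≡true-ext : ∀ {a b} → (a ≡ true → b ≡ true) → (b ≡ true → a ≡ true) → a ≡ b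
≡true-ext {false} {false} _ _ = refl
≡true-ext {false} {true} _ k = k refl
≡true-ext {true} {false} h _ = sym (h refl)
≡true-ext {true} {true} _ _ = refl

≤ᵇ≡true⇒≤ : ∀ {m n} → (m ≤ᵇ n) ≡ true → m ≤ n
≤ᵇ≡true⇒≤ {m} {n} e = ℕₚ.≤ᵇ⇒≤ m n (subst T (sym e) _)

≤⇒≤ᵇ≡true : ∀ {m n} → m ≤ n → (m ≤ᵇ n) ≡ true
≤⇒≤ᵇ≡true {m} {n} m≤n with m ≤ᵇ n | ℕₚ.≤⇒≤ᵇ m≤n
... | true | _ = refl

module _ {A : Set} {x y : A} where

  ⌊⌋≡true⇒ : (d : Dec (x ≡ y)) → ⌊ d ⌋ ≡ true → x ≡ y
  ⌊⌋≡true⇒ (yes e) _ = e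

  ⌊⌋≡true⇐ : (d : Dec (x ≡ y)) → x ≡ y → ⌊ d ⌋ ≡ true
  ⌊⌋≡true⇐ (yes _) _ = refl
  ⌊⌋≡true⇐ (no ne) e = ⊥-elim (ne e)

  ⌊⌋≡false⇒ : (d : Dec (x ≡ y)) → ⌊ d ⌋ ≡ false → x ≢ y
  ⌊⌋≡false⇒ (no ne) _ = ne

  ⌊⌋≡false⇐ : (d : Dec (x ≡ y)) → x ≢ y → ⌊ d ⌋ ≡ false
  ⌊⌋≡false⇐ (yes e) ne = ⊥-elim (ne e)
  ⌊⌋≡false⇐ (no _) _ = refl

module _ {A : Set} where

  all-true⇒ : (P : A → Bool) (xs : List A) → all P xs ≡ true → ∀ {x} → x ∈ xs → P x ≡ true
  all-true⇒ P (y ∷ xs) e (here refl) = ∧-trueˡ e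
  all-true⇒ P (y ∷ xs) e (there x∈xs) = all-true⇒ P xs (∧-trueʳ {P y} e) x∈xs

  all-true⇐ : (P : A → Bool) (xs : List A) → (∀ {x} → x ∈ xs → P x ≡ true) → all P xs ≡ true
  all-true⇐ P [] _ = refl
  all-true⇐ P (y ∷ xs) h = ∧-true (h (here refl)) (all-true⇐ P xs (h ∘ there))

  all-false⇒ : (P : A → Bool) (xs : List A) → all P xs ≡ false → ∃[ x ] (x ∈ xs × P x ≡ false)
  all-false⇒ P (y ∷ xs) e with P y in eq
  ... | false = y , here refl , eq
  ... | true = let (x , x∈xs , px) = all-false⇒ P xs e in x , there x∈xs , px

  any-true⇒ : (P : A → Bool) (xs : List A) → any P xs ≡ true → ∃[ x ] (x ∈ xs × P x ≡ true)
  any-true⇒ P (y ∷ xs) e with P y in eq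
  ... | true = y , here refl , eq
  ... | false = let (x , x∈xs , px) = any-true⇒ P xs e in x , there x∈xs , px

  any-true⇐ : (P : A → Bool) (xs : List A) {x : A} → x ∈ xs → P x ≡ true → any P xs ≡ true
  any-true⇐ P (y ∷ xs) (here refl) px rewrite px = refl
  any-true⇐ P (y ∷ xs) (there x∈xs) px with P y
  ... | true = refl
  ... | false = any-true⇐ P xs x∈xs px

  all-cong-∈ : {P Q : A → Bool} (xs : List A) → (∀ x → x ∈ xs → P x ≡ Q x) → all P xs ≡ all Q xs
  all-cong-∈ [] _ = refl
  all-cong-∈ (x ∷ xs) h = cong₂ _∧_ (h x (here refl)) (all-cong-∈ xs (λ y → h y ∘ there))

  all-cong : {P Q : A → Bool} → (∀ x → P x ≡ Q x) → ∀ xs → all P xs ≡ all Q xs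
  all-cong h xs = all-cong-∈ xs (λ x _ → h x)

  any-cong : {P Q : A → Bool} → (∀ x → P x ≡ Q x) → ∀ xs → any P xs ≡ any Q xs
  any-cong h [] = refl
  any-cong h (x ∷ xs) = cong₂ _∨_ (h x) (any-cong h xs)

  all-not≡not-any : (P : A → Bool) (xs : List A) → all (not ∘ P) xs ≡ not (any P xs)
  all-not≡not-any P [] = refl
  all-not≡not-any P (x ∷ xs) with P x
  ... | true = refl
  ... | false = all-not≡not-any P xs

  count : (A → Bool) → List A → ℕ
  count P xs = length (filterᵇ P xs)

  filterᵇ-cong : {P Q : A → Bool} → (∀ x → P x ≡ Q x) → ∀ xs → filterᵇ P xs ≡ filterᵇ Q xs
  filterᵇ-cong h [] = refl
  filterᵇ-cong {Q = Q} h (x ∷ xs) rewrite h x with Q x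
  ... | true = cong (x ∷_) (filterᵇ-cong h xs)
  ... | false = filterᵇ-cong h xs

  count-cong : {P Q : A → Bool} → (∀ x → P x ≡ Q x) → ∀ xs → count P xs ≡ count Q xs
  count-cong h xs = cong length (filterᵇ-cong h xs)

  ∈-filterᵇ⁺ : (P : A → Bool) (xs : List A) {x : A} → x ∈ xs → P x ≡ true → x ∈ filterᵇ P xs
  ∈-filterᵇ⁺ P (y ∷ xs) (here refl) px rewrite px = here refl
  ∈-filterᵇ⁺ P (y ∷ xs) (there x∈xs) px with P y
  ... | true = there (∈-filterᵇ⁺ P xs x∈xs px)
  ... | false = ∈-filterᵇ⁺ P xs x∈xs px

  ∈-filterᵇ⁻ : (P : A → Bool) (xs : List A) {x : A} → x ∈ filterᵇ P xs → x ∈ xs × P x ≡ true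
  ∈-filterᵇ⁻ P (y ∷ xs) x∈ with P y in eq
  ∈-filterᵇ⁻ P (y ∷ xs) (here refl) | true = here refl , eq
  ∈-filterᵇ⁻ P (y ∷ xs) (there x∈) | true = let (x∈xs , px) = ∈-filterᵇ⁻ P xs x∈ in there x∈xs , px
  ... | false = let (x∈xs , px) = ∈-filterᵇ⁻ P xs x∈ in there x∈xs , px

  count≡0⇒ : (P : A → Bool) (xs : List A) → count P xs ≡ 0 → ∀ {x} → x ∈ xs → P x ≡ false
  count≡0⇒ P (y ∷ xs) e x∈ with P y in eq
  count≡0⇒ P (y ∷ xs) () x∈ | true
  count≡0⇒ P (y ∷ xs) e (here refl) | false = eq
  count≡0⇒ P (y ∷ xs) e (there x∈xs) | false = count≡0⇒ P xs e x∈xs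

  count>0⇒ : (P : A → Bool) (xs : List A) → 0 < count P xs → ∃[ x ] (x ∈ xs × P x ≡ true)
  count>0⇒ P xs pos with filterᵇ P xs in eq
  ... | x ∷ _ = let (x∈xs , px) = ∈-filterᵇ⁻ P xs (subst (x ∈_) (sym eq) (here refl)) in x , x∈xs , px

  count-none : (P : A → Bool) (xs : List A) → (∀ x → P x ≡ false) → count P xs ≡ 0
  count-none P [] _ = refl
  count-none P (x ∷ xs) h rewrite h x = count-none P xs h

count-map : {A C : Set} (P : C → Bool) (f : A → C) (xs : List A) → count P (map f xs) ≡ count (P ∘ f) xs
count-map P f [] = refl
count-map P f (x ∷ xs) with P (f x)
... | true = cong suc (count-map P f xs)
... | false = count-map P f xs

all-map : {A C : Set} (P : C → Bool) (f : A → C) (xs : List A) → all P (map f xs) ≡ all (P ∘ f) xs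
all-map P f [] = refl
all-map P f (x ∷ xs) = cong (P (f x) ∧_) (all-map P f xs)

boolToℕ : Bool → ℕ
boolToℕ true = 1
boolToℕ false = 0

count-const-true : {A : Set} (xs : List A) → count (λ _ → true) xs ≡ length xs
count-const-true [] = refl
count-const-true (x ∷ xs) = cong suc (count-const-true xs)

count-allFin-true : ∀ n → count {Fin n} (λ _ → true) (allFin n) ≡ n
count-allFin-true n = trans (count-const-true (allFin n)) (Listₚ.length-tabulate (λ i → i))

module _ {n : ℕ} where

  allFin-suc : allFin (suc n) ≡ zero ∷ map suc (allFin n)
  allFin-suc = cong (zero ∷_) (sym (Listₚ.map-tabulate (λ i → i) suc))

  count-allFin-suc : (P : Fin (suc n) → Bool) →
    count P (allFin (suc n)) ≡ boolToℕ (P zero) ℕ.+ count (P ∘ suc) (allFin n)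
  count-allFin-suc P = trans (cong (count P) allFin-suc) count-cons
    where
    count-cons : count P (zero ∷ map suc (allFin n)) ≡ boolToℕ (P zero) ℕ.+ count (P ∘ suc) (allFin n)
    count-cons with P zero
    ... | true = cong suc (count-map P suc (allFin n))
    ... | false = count-map P suc (allFin n)

  all-allFin-suc : (P : Fin (suc n) → Bool) → all P (allFin (suc n)) ≡ P zero ∧ all (P ∘ suc) (allFin n)
  all-allFin-suc P = trans (cong (all P) allFin-suc) (cong (P zero ∧_) (all-map P suc (allFin n)))

⌊suc≟suc⌋ : ∀ {n} (a b : Fin n) → ⌊ suc a Fin.≟ suc b ⌋ ≡ ⌊ a Fin.≟ b ⌋
⌊suc≟suc⌋ a b with a Fin.≟ b
... | yes _ = refl
... | no _ = refl

⌊≟⌋-sym : ∀ {N} (x y : Fin N) → ⌊ x Fin.≟ y ⌋ ≡ ⌊ y Fin.≟ x ⌋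
⌊≟⌋-sym x y with x Fin.≟ y | y Fin.≟ x
... | yes _ | yes _ = refl
... | no _ | no _ = refl
... | yes x≡y | no y≢x = ⊥-elim (y≢x (sym x≡y))
... | no x≢y | yes y≡x = ⊥-elim (x≢y (sym y≡x))

delete : ∀ {N} → (Fin N → Bool) → Fin N → Fin N → Bool
delete P y x = P x ∧ not ⌊ y Fin.≟ x ⌋

count-delete : ∀ {N} (P : Fin N → Bool) (y : Fin N) →
  count (delete P y) (allFin N) ℕ.+ boolToℕ (P y) ≡ count P (allFin N)
count-delete {suc N} P zero = begin
  count (delete P zero) (allFin (suc N)) ℕ.+ boolToℕ (P zero)
    ≡⟨ cong (ℕ._+ boolToℕ (P zero)) (count-allFin-suc (delete P zero)) ⟩
  boolToℕ (P zero ∧ false) ℕ.+ count (λ x → P (suc x) ∧ true) (allFin N) ℕ.+ boolToℕ (P zero)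
    ≡⟨ cong₂ (λ a b → a ℕ.+ b ℕ.+ boolToℕ (P zero)) (cong boolToℕ (Boolₚ.∧-zeroʳ (P zero)))
                                                    (count-cong (Boolₚ.∧-identityʳ ∘ P ∘ suc) (allFin N)) ⟩
  count (P ∘ suc) (allFin N) ℕ.+ boolToℕ (P zero)
    ≡⟨ ℕₚ.+-comm (count (P ∘ suc) (allFin N)) _ ⟩
  boolToℕ (P zero) ℕ.+ count (P ∘ suc) (allFin N)
    ≡⟨ count-allFin-suc P ⟨
  count P (allFin (suc N)) ∎
  where open ≡-Reasoning
count-delete {suc N} P (suc y) = begin
  count (delete P (suc y)) (allFin (suc N)) ℕ.+ boolToℕ (P (suc y))
    ≡⟨ cong (ℕ._+ boolToℕ (P (suc y))) (count-allFin-suc (delete P (suc y))) ⟩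
  boolToℕ (P zero ∧ true) ℕ.+ count (λ x → P (suc x) ∧ not ⌊ suc y Fin.≟ suc x ⌋) (allFin N) ℕ.+ boolToℕ (P (suc y))
    ≡⟨ cong₂ (λ a b → a ℕ.+ b ℕ.+ boolToℕ (P (suc y))) (cong boolToℕ (Boolₚ.∧-identityʳ (P zero)))
              (count-cong (λ x → cong (λ b → P (suc x) ∧ not b) (⌊suc≟suc⌋ y x)) (allFin N)) ⟩
  boolToℕ (P zero) ℕ.+ count (delete (P ∘ suc) y) (allFin N) ℕ.+ boolToℕ (P (suc y))
    ≡⟨ ℕₚ.+-assoc (boolToℕ (P zero)) _ _ ⟩
  boolToℕ (P zero) ℕ.+ (count (delete (P ∘ suc) y) (allFin N) ℕ.+ boolToℕ (P (suc y)))
    ≡⟨ cong (boolToℕ (P zero) ℕ.+_) (count-delete (P ∘ suc) y) ⟩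
  boolToℕ (P zero) ℕ.+ count (P ∘ suc) (allFin N)
    ≡⟨ count-allFin-suc P ⟨
  count P (allFin (suc N)) ∎
  where open ≡-Reasoning

count-suc-delete : ∀ {N} (P : Fin N → Bool) a → P a ≡ true →
  count P (allFin N) ≡ suc (count (delete P a) (allFin N))
count-suc-delete {N} P a pa =
  trans (sym (count-delete P a)) (trans (cong (λ b → c ℕ.+ boolToℕ b) pa) (ℕₚ.+-comm c 1))
  where
  c : ℕ
  c = count (delete P a) (allFin N)

notInImage : ∀ {m N} → (Fin m → Fin N) → Fin N → Bool
notInImage {m} s x = all (λ i → not ⌊ s i Fin.≟ x ⌋) (allFin m)

notInImage-true⇒ : ∀ {m N} (s : Fin m → Fin N) x → notInImage s x ≡ true → ∀ i → s i ≢ x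
notInImage-true⇒ s x e i sᵢ≡x =
  true≢false (trans (sym (⌊⌋≡true⇐ (s i Fin.≟ x) sᵢ≡x)) (not≡true⇒≡false (all-true⇒ _ _ e (∈-allFin i))))

notInImage-true⇐ : ∀ {m N} (s : Fin m → Fin N) x → (∀ i → s i ≢ x) → notInImage s x ≡ true
notInImage-true⇐ {m} s x h = all-true⇐ _ (allFin m) (λ {i} _ → ≡false⇒not≡true (⌊⌋≡false⇐ (s i Fin.≟ x) (h i)))

count-outside-image : ∀ {m N} (s : Fin m → Fin N) → Injective _≡_ _≡_ s → (P : Fin N → Bool) →
  count (λ x → P x ∧ notInImage s x) (allFin N) ℕ.+ count (P ∘ s) (allFin m) ≡ count P (allFin N)
count-outside-image {zero} {N} s _ P =
  trans (ℕₚ.+-identityʳ _) (count-cong (Boolₚ.∧-identityʳ ∘ P) (allFin N))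
count-outside-image {suc m} {N} s inj P = begin
  count (λ x → P x ∧ notInImage s x) (allFin N) ℕ.+ count (P ∘ s) (allFin (suc m))
    ≡⟨ cong₂ ℕ._+_ (count-cong notInImage-split (allFin N)) (count-allFin-suc (P ∘ s)) ⟩
  a ℕ.+ (i ℕ.+ b)
    ≡⟨ cong (a ℕ.+_) (ℕₚ.+-comm i b) ⟩
  a ℕ.+ (b ℕ.+ i)
    ≡⟨ ℕₚ.+-assoc a b i ⟨
  a ℕ.+ b ℕ.+ i
    ≡⟨ cong (λ c → a ℕ.+ c ℕ.+ i) (count-cong delete-on-tail (allFin m)) ⟨
  a ℕ.+ count (delete P (s zero) ∘ s ∘ suc) (allFin m) ℕ.+ i
    ≡⟨ cong (ℕ._+ i) (count-outside-image (s ∘ suc) (Finₚ.suc-injective ∘ inj) (delete P (s zero))) ⟩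
  count (delete P (s zero)) (allFin N) ℕ.+ i
    ≡⟨ count-delete P (s zero) ⟩
  count P (allFin N) ∎
  where
  open ≡-Reasoning
  a b i : ℕ
  a = count (λ x → delete P (s zero) x ∧ notInImage (s ∘ suc) x) (allFin N)
  b = count (P ∘ s ∘ suc) (allFin m)
  i = boolToℕ (P (s zero))
  notInImage-split : ∀ x → P x ∧ notInImage s x ≡ delete P (s zero) x ∧ notInImage (s ∘ suc) x
  notInImage-split x = trans (cong (P x ∧_) (all-allFin-suc (λ i → not ⌊ s i Fin.≟ x ⌋)))
                             (sym (Boolₚ.∧-assoc (P x) _ _))
  delete-on-tail : ∀ j → delete P (s zero) (s (suc j)) ≡ P (s (suc j))
  delete-on-tail j = trans (cong (λ b → P (s (suc j)) ∧ not b)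
                               (⌊⌋≡false⇐ (s zero Fin.≟ s (suc j)) (Finₚ.0≢1+n ∘ inj)))
                         (Boolₚ.∧-identityʳ _)

count-single : ∀ {N} (y : Fin N) (R : Fin N → Bool) →
  count (λ x → ⌊ y Fin.≟ x ⌋ ∧ R x) (allFin N) ≡ boolToℕ (R y)
count-single {N} y R = begin
  count Q (allFin N)
    ≡⟨ count-delete Q y ⟨
  count (delete Q y) (allFin N) ℕ.+ boolToℕ (Q y)
    ≡⟨ cong (ℕ._+ boolToℕ (Q y)) (count-none _ (allFin N) Q∖y-empty) ⟩
  boolToℕ (Q y)
    ≡⟨ cong (λ b → boolToℕ (b ∧ R y)) (⌊⌋≡true⇐ (y Fin.≟ y) refl) ⟩
  boolToℕ (R y) ∎
  where
  open ≡-Reasoning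
  Q : Fin N → Bool
  Q x = ⌊ y Fin.≟ x ⌋ ∧ R x
  Q∖y-empty : ∀ x → delete Q y x ≡ false
  Q∖y-empty x with ⌊ y Fin.≟ x ⌋
  ... | false = refl
  ... | true = Boolₚ.∧-zeroʳ (R x)

count-unique : ∀ {N} (P : Fin N → Bool) y → P y ≡ true → (∀ x → P x ≡ true → x ≡ y) → count P (allFin N) ≡ 1
count-unique {N} P y py unique =
  trans (count-cong P≡at-y (allFin N)) (trans (count-single y P) (cong boolToℕ py))
  where
  P≡at-y : ∀ x → P x ≡ ⌊ y Fin.≟ x ⌋ ∧ P x
  P≡at-y x with P x in px
  ... | false = sym (Boolₚ.∧-zeroʳ _)
  ... | true = sym (cong (_∧ true) (⌊⌋≡true⇐ (y Fin.≟ x) (sym (unique x px))))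

count≥2⇒two-distinct : ∀ {N} (P : Fin N → Bool) → 2 ≤ count P (allFin N) →
  ∃[ a ] ∃[ b ] (a ≢ b × P a ≡ true × P b ≡ true)
count≥2⇒two-distinct {N} P 2≤ =
  let (a , _ , pa) = count>0⇒ P (allFin N) (ℕₚ.≤-trans (s≤s z≤n) 2≤)
      (b , _ , pb) = count>0⇒ _ (allFin N) (ℕ.s≤s⁻¹ (subst (2 ≤_) (count-suc-delete P a pa) 2≤))
  in a , b , ⌊⌋≡false⇒ (a Fin.≟ b) (not≡true⇒≡false (∧-trueʳ pb)) , pa , ∧-trueˡ pb

count≤1⇒unique : ∀ {N} (P : Fin N → Bool) → count P (allFin N) ≤ 1 →
  ∀ {x y} → P x ≡ true → P y ≡ true → x ≡ y
count≤1⇒unique {N} P ≤1 {x} {y} px py with x Fin.≟ y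
... | yes x≡y = x≡y
... | no x≢y = ⊥-elim (ℕₚ.<⇒≱ 2≤count ≤1)
  where
  2≤count : 2 ≤ count P (allFin N)
  2≤count = subst (2 ≤_) (sym (count-suc-delete P x px))
              (s≤s (subst (1 ≤_) (sym (count-suc-delete (delete P x) y
                                        (∧-true py (≡false⇒not≡true (⌊⌋≡false⇐ (x Fin.≟ y) x≢y)))))
                          (s≤s z≤n)))

delete-true⁻ : ∀ {N} (P : Fin N → Bool) a x → P x ≡ true → x ≡ a ⊎ delete P a x ≡ true
delete-true⁻ P a x px with a Fin.≟ x
... | yes a≡x = inj₁ (sym a≡x)
... | no _ = inj₂ (∧-true px refl)

count-delete≤1⇒covered : ∀ {N} (P : Fin N → Bool) a → count (delete P a) (allFin N) ≤ 1 →
  ∃[ b ] (∀ x → P x ≡ true → x ≡ a ⊎ x ≡ b)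
count-delete≤1⇒covered {N} P a ≤1 with count (delete P a) (allFin N) in eq
... | zero = a , λ x px → [ inj₁ , (λ e → ⊥-elim (true≢false (trans (sym e) (count≡0⇒ _ (allFin N) eq (∈-allFin x))))) ]
                            (delete-true⁻ P a x px)
... | suc _ with count>0⇒ (delete P a) (allFin N) (subst (0 <_) (sym eq) (s≤s z≤n))
... | (b , _ , pb) = b , λ x px → map₂ (λ e → count≤1⇒unique (delete P a) (subst (_≤ 1) (sym eq) ≤1) e pb)
                                                (delete-true⁻ P a x px)

count≤2⇒covered-by-two : ∀ {N} (P : Fin N → Bool) → count P (allFin N) ≤ 2 →
  (∀ x → P x ≡ false) ⊎ ∃[ a ] ∃[ b ] (∀ x → P x ≡ true → x ≡ a ⊎ x ≡ b)
count≤2⇒covered-by-two {N} P ≤2 with count P (allFin N) in eq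
... | zero = inj₁ (λ x → count≡0⇒ P (allFin N) eq (∈-allFin x))
... | suc _ with count>0⇒ P (allFin N) (subst (0 <_) (sym eq) (s≤s z≤n))
... | (a , _ , pa) =
  inj₂ (a , count-delete≤1⇒covered P a (ℕ.s≤s⁻¹ (subst (_≤ 2) (trans (sym eq) (count-suc-delete P a pa)) ≤2)))

∑ : {A : Set} → (A → ℤ) → List A → ℤ
∑ F xs = sumℤ (map F xs)

boolToℤ : Bool → ℤ
boolToℤ b = + boolToℕ b

module _ {A : Set} where

  ∑-cong : {F G : A → ℤ} → (∀ x → F x ≡ G x) → ∀ xs → ∑ F xs ≡ ∑ G xs
  ∑-cong h [] = refl
  ∑-cong h (x ∷ xs) = cong₂ _+_ (h x) (∑-cong h xs)

  ∑-++ : (F : A → ℤ) (xs ys : List A) → ∑ F (xs ++ ys) ≡ ∑ F xs + ∑ F ys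
  ∑-++ F [] ys = sym (ℤₚ.+-identityˡ _)
  ∑-++ F (x ∷ xs) ys = trans (cong (λ z → F x + z) (∑-++ F xs ys)) (sym (ℤₚ.+-assoc (F x) _ _))

  ∑-zero : (F : A → ℤ) (xs : List A) → (∀ x → F x ≡ + 0) → ∑ F xs ≡ + 0
  ∑-zero F [] _ = refl
  ∑-zero F (x ∷ xs) h rewrite h x = trans (ℤₚ.+-identityˡ _) (∑-zero F xs h)

  ∑-+ : (F G : A → ℤ) (xs : List A) → ∑ (λ x → F x + G x) xs ≡ ∑ F xs + ∑ G xs
  ∑-+ F G [] = refl
  ∑-+ F G (x ∷ xs) = trans (cong (λ z → F x + G x + z) (∑-+ F G xs)) (interchange (F x) (G x) (∑ F xs) (∑ G xs))
    where
    interchange : ∀ a b c d → (a + b) + (c + d) ≡ (a + c) + (b + d)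
    interchange = solve-∀

  *-distribˡ-∑ : (c : ℤ) (F : A → ℤ) (xs : List A) → c * ∑ F xs ≡ ∑ (λ x → c * F x) xs
  *-distribˡ-∑ c F [] = ℤₚ.*-zeroʳ c
  *-distribˡ-∑ c F (x ∷ xs) = trans (ℤₚ.*-distribˡ-+ c (F x) (∑ F xs)) (cong (λ z → c * F x + z) (*-distribˡ-∑ c F xs))

  ∑-filterᵇ : (F : A → ℤ) (P : A → Bool) (xs : List A) →
    ∑ F (filterᵇ P xs) ≡ ∑ (λ x → if P x then F x else + 0) xs
  ∑-filterᵇ F P [] = refl
  ∑-filterᵇ F P (x ∷ xs) with P x
  ... | true = cong (λ z → F x + z) (∑-filterᵇ F P xs)
  ... | false = trans (∑-filterᵇ F P xs) (sym (ℤₚ.+-identityˡ _))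

  count-as-∑ : (P : A → Bool) (xs : List A) → + count P xs ≡ ∑ (boolToℤ ∘ P) xs
  count-as-∑ P [] = refl
  count-as-∑ P (x ∷ xs) with P x
  ... | true = trans (ℤₚ.pos-+ 1 (count P xs)) (cong (λ z → + 1 + z) (count-as-∑ P xs))
  ... | false = trans (count-as-∑ P xs) (sym (ℤₚ.+-identityˡ _))

  sum-as-∑ : (F : A → ℕ) (xs : List A) → + sum (map F xs) ≡ ∑ (+_ ∘ F) xs
  sum-as-∑ F [] = refl
  sum-as-∑ F (x ∷ xs) = trans (ℤₚ.pos-+ (F x) _) (cong (λ z → + F x + z) (sum-as-∑ F xs))

∑-map : {A C : Set} (F : C → ℤ) (g : A → C) (xs : List A) → ∑ F (map g xs) ≡ ∑ (F ∘ g) xs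
∑-map F g [] = refl
∑-map F g (x ∷ xs) = cong (λ z → F (g x) + z) (∑-map F g xs)

∑-concatMap : {A C : Set} (F : C → ℤ) (G : A → List C) (xs : List A) →
  ∑ F (concatMap G xs) ≡ ∑ (λ x → ∑ F (G x)) xs
∑-concatMap F G [] = refl
∑-concatMap F G (x ∷ xs) = trans (∑-++ F (G x) (concatMap G xs)) (cong (λ z → ∑ F (G x) + z) (∑-concatMap F G xs))

∑-comm : {A C : Set} (F : A → C → ℤ) (xs : List A) (ys : List C) →
  ∑ (λ x → ∑ (F x) ys) xs ≡ ∑ (λ y → ∑ (λ x → F x y) xs) ys
∑-comm F [] ys = sym (∑-zero _ ys (λ _ → refl))
∑-comm F (x ∷ xs) ys =
  trans (cong (λ z → ∑ (F x) ys + z) (∑-comm F xs ys)) (sym (∑-+ (F x) (λ y → ∑ (λ x → F x y) xs) ys))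

_⊑_ : ∀ {n} → Subset n → Subset n → Set
S ⊑ T = ∀ i → lookup S i ≡ true → lookup T i ≡ true

≡ˢ-refl : ∀ {n} (S : Subset n) → (S ≡ˢ S) ≡ true
≡ˢ-refl Vec.[] = refl
≡ˢ-refl (a Vec.∷ S) = ∧-true (⌊⌋≡true⇐ (a Bool.≟ a) refl) (≡ˢ-refl S)

≡ˢ⇒≡ : ∀ {n} (S T : Subset n) → (S ≡ˢ T) ≡ true → S ≡ T
≡ˢ⇒≡ Vec.[] Vec.[] _ = refl
≡ˢ⇒≡ (a Vec.∷ S) (b Vec.∷ T) e =
  cong₂ Vec._∷_ (⌊⌋≡true⇒ (a Bool.≟ b) (∧-trueˡ e)) (≡ˢ⇒≡ S T (∧-trueʳ {⌊ a Bool.≟ b ⌋} e))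

≢⇒≡ˢ-false : ∀ {n} (S T : Subset n) → S ≢ T → (S ≡ˢ T) ≡ false
≢⇒≡ˢ-false S T S≢T = Boolₚ.¬-not (S≢T ∘ ≡ˢ⇒≡ S T)

⊆ˢ⇒⊑ : ∀ {n} (S T : Subset n) → (S ⊆ˢ T) ≡ true → S ⊑ T
⊆ˢ⇒⊑ (a Vec.∷ S) (b Vec.∷ T) e zero = not-∨-elim (∧-trueˡ e)
⊆ˢ⇒⊑ (a Vec.∷ S) (b Vec.∷ T) e (suc i) = ⊆ˢ⇒⊑ S T (∧-trueʳ {not a ∨ b} e) i

⊑⇒⊆ˢ : ∀ {n} (S T : Subset n) → S ⊑ T → (S ⊆ˢ T) ≡ true
⊑⇒⊆ˢ Vec.[] Vec.[] _ = refl
⊑⇒⊆ˢ (a Vec.∷ S) (b Vec.∷ T) h = ∧-true (not-∨-intro (h zero)) (⊑⇒⊆ˢ S T (h ∘ suc))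

⊆ˢ⇒∣∣≤ : ∀ {n} (S T : Subset n) → (S ⊆ˢ T) ≡ true → ∣ S ∣ ≤ ∣ T ∣
⊆ˢ⇒∣∣≤ Vec.[] Vec.[] _ = z≤n
⊆ˢ⇒∣∣≤ (false Vec.∷ S) (false Vec.∷ T) e = ⊆ˢ⇒∣∣≤ S T e
⊆ˢ⇒∣∣≤ (false Vec.∷ S) (true Vec.∷ T) e = ℕₚ.m≤n⇒m≤1+n (⊆ˢ⇒∣∣≤ S T e)
⊆ˢ⇒∣∣≤ (true Vec.∷ S) (true Vec.∷ T) e = s≤s (⊆ˢ⇒∣∣≤ S T e)

⊂ˢ⇒∣∣< : ∀ {n} (S T : Subset n) → (S ⊂ˢ T) ≡ true → ∣ S ∣ < ∣ T ∣
⊂ˢ⇒∣∣< (false Vec.∷ S) (false Vec.∷ T) e = ⊂ˢ⇒∣∣< S T e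
⊂ˢ⇒∣∣< (false Vec.∷ S) (true Vec.∷ T) e = s≤s (⊆ˢ⇒∣∣≤ S T (∧-trueˡ e))
⊂ˢ⇒∣∣< (true Vec.∷ S) (true Vec.∷ T) e = s≤s (⊂ˢ⇒∣∣< S T e)
⊂ˢ⇒∣∣< (true Vec.∷ S) (false Vec.∷ T) ()
⊂ˢ⇒∣∣< Vec.[] Vec.[] ()

∣∣≡count : ∀ {n} (S : Subset n) → ∣ S ∣ ≡ count (lookup S) (allFin n)
∣∣≡count Vec.[] = refl
∣∣≡count {suc n} (b Vec.∷ S) =
  trans (card-cons b) (trans (cong (boolToℕ b ℕ.+_) (∣∣≡count S)) (sym (count-allFin-suc (lookup (b Vec.∷ S)))))
  where
  card-cons : ∀ b → ∣ b Vec.∷ S ∣ ≡ boolToℕ b ℕ.+ ∣ S ∣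
  card-cons false = refl
  card-cons true = refl

∣insertAt-inside∣ : ∀ {m} (K : Subset m) p → ∣ Vec.insertAt K p true ∣ ≡ suc ∣ K ∣
∣insertAt-inside∣ K zero = refl
∣insertAt-inside∣ (false Vec.∷ K) (suc p) = ∣insertAt-inside∣ K p
∣insertAt-inside∣ (true Vec.∷ K) (suc p) = cong suc (∣insertAt-inside∣ K p)

insertAt-outside⊆ˢinside : ∀ {m} (K : Subset m) p → (Vec.insertAt K p false ⊆ˢ Vec.insertAt K p true) ≡ true
insertAt-outside⊆ˢinside K zero = ⊑⇒⊆ˢ K K (λ _ e → e)
insertAt-outside⊆ˢinside (b Vec.∷ K) (suc p) = ∧-true (Boolₚ.∨-inverseˡ b) (insertAt-outside⊆ˢinside K p)

[]≔true-self : ∀ {m} (K : Subset m) i → lookup (K [ i ]≔ true) i ≡ true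
[]≔true-self K i = Vecₚ.lookup∘update i K true

[]≔true-keeps : ∀ {m} (K : Subset m) i → K ⊑ (K [ i ]≔ true)
[]≔true-keeps K i j e with i Fin.≟ j
... | yes refl = []≔true-self K i
... | no i≢j = trans (Vecₚ.lookup∘update′ (i≢j ∘ sym) K true) e

[]≔true⁻ : ∀ {m} (K : Subset m) i j → lookup (K [ i ]≔ true) j ≡ true → j ≡ i ⊎ lookup K j ≡ true
[]≔true⁻ K i j e with j Fin.≟ i
... | yes j≡i = inj₁ j≡i
... | no j≢i = inj₂ (trans (sym (Vecₚ.lookup∘update′ j≢i K true)) e)

∈-∩⁻ : ∀ {n} (S T : Subset n) i → lookup (S ∩ T) i ≡ true → lookup S i ≡ true × lookup T i ≡ true
∈-∩⁻ S T i e = let e′ = trans (sym (Vecₚ.lookup-zipWith _∧_ i S T)) e in ∧-trueˡ e′ , ∧-trueʳ {lookup S i} e′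

∈-∪⁻ : ∀ {n} (S T : Subset n) i → lookup (S ∪ T) i ≡ true → lookup S i ≡ true ⊎ lookup T i ≡ true
∈-∪⁻ S T i e = ∨-true⁻ (trans (sym (Vecₚ.lookup-zipWith _∨_ i S T)) e)
  where
  ∨-true⁻ : ∀ {a b} → a ∨ b ≡ true → a ≡ true ⊎ b ≡ true
  ∨-true⁻ {true} _ = inj₁ refl
  ∨-true⁻ {false} e = inj₂ e

⊑-∪ˡ : ∀ {n} (S T : Subset n) → S ⊑ (S ∪ T)
⊑-∪ˡ S T i e = trans (Vecₚ.lookup-zipWith _∨_ i S T) (cong (_∨ lookup T i) e)

⊑-∪ʳ : ∀ {n} (S T : Subset n) → T ⊑ (S ∪ T)
⊑-∪ʳ S T i e = trans (Vecₚ.lookup-zipWith _∨_ i S T) (trans (cong (lookup S i ∨_) e) (Boolₚ.∨-zeroʳ _))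

extendSubsets : ∀ {n} → List (Subset n) → List (Subset (suc n))
extendSubsets = concatMap (λ s → (outside Vec.∷ s) ∷ (inside Vec.∷ s) ∷ [])

∈-extendSubsets⁺ : ∀ {n} b (S : Subset n) ys → S ∈ ys → (b Vec.∷ S) ∈ extendSubsets ys
∈-extendSubsets⁺ false S (y ∷ ys) (here refl) = here refl
∈-extendSubsets⁺ true S (y ∷ ys) (here refl) = there (here refl)
∈-extendSubsets⁺ b S (y ∷ ys) (there S∈ys) = there (there (∈-extendSubsets⁺ b S ys S∈ys))

∈-extendSubsets⁻ : ∀ {n} b (S : Subset n) ys → (b Vec.∷ S) ∈ extendSubsets ys → S ∈ ys
∈-extendSubsets⁻ b S (y ∷ ys) (here refl) = here refl
∈-extendSubsets⁻ b S (y ∷ ys) (there (here refl)) = here refl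
∈-extendSubsets⁻ b S (y ∷ ys) (there (there S∈)) = there (∈-extendSubsets⁻ b S ys S∈)

extendSubsets-unique : ∀ {n} {ys : List (Subset n)} → Unique ys → Unique (extendSubsets ys)
extendSubsets-unique [] = []
extendSubsets-unique {ys = y ∷ ys} (y∉ys ∷ unique) =
  ((λ ()) ∷ fresh outside) ∷ fresh inside ∷ extendSubsets-unique unique
  where
  fresh : ∀ b → All ((b Vec.∷ y) ≢_) (extendSubsets ys)
  fresh b = ¬Any⇒All¬ _ (All¬⇒¬Any y∉ys ∘ ∈-extendSubsets⁻ b y ys)

allSubsets-complete : ∀ {n} (S : Subset n) → S ∈ allSubsets n
allSubsets-complete Vec.[] = here refl
allSubsets-complete {suc n} (b Vec.∷ S) = ∈-extendSubsets⁺ b S (allSubsets n) (allSubsets-complete S)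

allSubsets-unique : ∀ n → Unique (allSubsets n)
allSubsets-unique zero = [] ∷ []
allSubsets-unique (suc n) = extendSubsets-unique (allSubsets-unique n)

agreeOn : ∀ {n} → List (Subset n) → BoolFun n → BoolFun n → Bool
agreeOn L g h = all (λ S → ⌊ g S Bool.≟ h S ⌋) L

DependsOnlyOn : ∀ {n} {X : Set} → List (Subset n) → (BoolFun n → X) → Set
DependsOnlyOn L W = ∀ g g′ → (∀ S → S ∈ L → g S ≡ g′ S) → W g ≡ W g′

Extensional : ∀ {n} {X : Set} → (BoolFun n → X) → Set
Extensional W = ∀ g g′ → (∀ S → g S ≡ g′ S) → W g ≡ W g′

∑-funsOn-agreeing : ∀ {n} (L : List (Subset n)) → Unique L → (h : BoolFun n) (W : BoolFun n → ℤ) →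
  DependsOnlyOn L W → ∑ (λ g → if agreeOn L g h then W g else + 0) (funsOn L) ≡ W h
∑-funsOn-agreeing [] _ h W dep = trans (ℤₚ.+-identityʳ _) (dep _ h (λ S ()))
∑-funsOn-agreeing {n} (x ∷ xs) (x∉xs ∷ unique) h W dep = begin
  ∑ F (funsOn (x ∷ xs))
    ≡⟨ ∑-concatMap F (λ g → set g x false ∷ set g x true ∷ []) (funsOn xs) ⟩
  ∑ (λ g → ∑ F (set g x false ∷ set g x true ∷ [])) (funsOn xs)
    ≡⟨ ∑-cong both-values (funsOn xs) ⟩
  ∑ (λ g → if agreeOn xs g h then W (set g x (h x)) else + 0) (funsOn xs)
    ≡⟨ ∑-funsOn-agreeing xs unique h (λ g → W (set g x (h x))) dep-set ⟩
  W (set h x (h x))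
    ≡⟨ dep _ h (λ S _ → set-same S) ⟩
  W h ∎
  where
  open ≡-Reasoning
  set : BoolFun n → Subset n → Bool → BoolFun n
  set g T b S = if S ≡ˢ T then b else g S
  F : BoolFun n → ℤ
  F g = if agreeOn (x ∷ xs) g h then W g else + 0
  x≢ : ∀ y → y ∈ xs → (y ≡ˢ x) ≡ false
  x≢ y y∈xs = ≢⇒≡ˢ-false y x (λ y≡x → Data.List.Relation.Unary.All.lookup x∉xs y∈xs (sym y≡x))
  agree-set : ∀ g b → agreeOn (x ∷ xs) (set g x b) h ≡ ⌊ b Bool.≟ h x ⌋ ∧ agreeOn xs g h
  agree-set g b =
    cong₂ _∧_ (cong (λ c → ⌊ (if c then b else g x) Bool.≟ h x ⌋) (≡ˢ-refl x))
              (all-cong-∈ xs (λ y y∈xs → cong (λ c → ⌊ (if c then b else g y) Bool.≟ h y ⌋) (x≢ y y∈xs)))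
  both-values : ∀ g → ∑ F (set g x false ∷ set g x true ∷ []) ≡ (if agreeOn xs g h then W (set g x (h x)) else + 0)
  both-values g rewrite agree-set g false | agree-set g true with h x | agreeOn xs g h
  ... | false | false = refl
  ... | false | true = ℤₚ.+-identityʳ _
  ... | true | false = refl
  ... | true | true = trans (ℤₚ.+-identityˡ _) (ℤₚ.+-identityʳ _)
  dep-set : DependsOnlyOn xs (λ g → W (set g x (h x)))
  dep-set g g′ agree = dep _ _ agree-on-x∷xs
    where
    agree-on-x∷xs : ∀ S → S ∈ x ∷ xs → set g x (h x) S ≡ set g′ x (h x) S
    agree-on-x∷xs S S∈ with S ≡ˢ x in eq
    ... | true = refl
    ... | false with S∈
    ... | here refl = ⊥-elim (true≢false (trans (sym (≡ˢ-refl S)) eq))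
    ... | there S∈xs = agree S S∈xs
  set-same : ∀ S → set h x (h x) S ≡ h S
  set-same S with S ≡ˢ x in eq
  ... | true = cong h (sym (≡ˢ⇒≡ S x eq))
  ... | false = refl

Tuple : ℕ → ℕ → Set
Tuple n N = Fin n → Fin N

-- allMaps builds its tuples with pattern lambdas, so tuples can only be compared pointwise.
TupleExtensional : ∀ {n N} → (Tuple n N → ℤ) → Set
TupleExtensional F = ∀ t t′ → t ≗ t′ → F t ≡ F t′

insertAt-cong : ∀ {m N} (s s′ : Tuple m N) → s ≗ s′ → ∀ p x → insertAt s p x ≗ insertAt s′ p x
insertAt-cong s s′ s≗s′ zero x zero = refl
insertAt-cong s s′ s≗s′ zero x (suc j) = s≗s′ j
insertAt-cong {suc m} s s′ s≗s′ (suc p) x zero = s≗s′ zero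
insertAt-cong {suc m} s s′ s≗s′ (suc p) x (suc j) = insertAt-cong (s ∘ suc) (s′ ∘ suc) (s≗s′ ∘ suc) p x j

≡-or-punchIn : ∀ {m} (p j : Fin (suc m)) → j ≡ p ⊎ ∃[ i ] (j ≡ punchIn p i)
≡-or-punchIn p j with j Fin.≟ p
... | yes j≡p = inj₁ j≡p
... | no j≢p = inj₂ (punchOut (j≢p ∘ sym) , sym (Finₚ.punchIn-punchOut _))

∑-allMaps-suc : ∀ {m N} (F : Tuple (suc m) N → ℤ) → TupleExtensional F →
  ∑ F (allMaps (suc m) N) ≡ ∑ (λ x → ∑ (λ t → F (x ∷ᶠ t)) (allMaps m N)) (allFin N)
∑-allMaps-suc {m} {N} F ext =
  trans (∑-concatMap F _ (allFin N))
        (∑-cong (λ x → trans (∑-map F _ (allMaps m N))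
                             (∑-cong (λ t → ext _ _ (λ { zero → refl ; (suc i) → refl })) (allMaps m N)))
                (allFin N))

∑-allMaps-insertAt : ∀ {m N} (p : Fin (suc m)) (F : Tuple (suc m) N → ℤ) → TupleExtensional F →
  ∑ F (allMaps (suc m) N) ≡ ∑ (λ s → ∑ (λ x → F (insertAt s p x)) (allFin N)) (allMaps m N)
∑-allMaps-insertAt {m} {N} zero F ext = begin
  ∑ F (allMaps (suc m) N)
    ≡⟨ ∑-allMaps-suc F ext ⟩
  ∑ (λ x → ∑ (λ t → F (x ∷ᶠ t)) (allMaps m N)) (allFin N)
    ≡⟨ ∑-comm (λ x t → F (x ∷ᶠ t)) (allFin N) (allMaps m N) ⟩
  ∑ (λ s → ∑ (λ x → F (x ∷ᶠ s)) (allFin N)) (allMaps m N)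
    ≡⟨ ∑-cong (λ s → ∑-cong (λ x → ext _ _ (λ { zero → refl ; (suc i) → refl })) (allFin N))
              (allMaps m N) ⟩
  ∑ (λ s → ∑ (λ x → F (insertAt s zero x)) (allFin N)) (allMaps m N) ∎
  where open ≡-Reasoning
∑-allMaps-insertAt {suc m} {N} (suc p) F ext = begin
  ∑ F (allMaps (suc (suc m)) N)
    ≡⟨ ∑-allMaps-suc F ext ⟩
  ∑ (λ y → ∑ (λ t → F (y ∷ᶠ t)) (allMaps (suc m) N)) (allFin N)
    ≡⟨ ∑-cong (λ y → ∑-allMaps-insertAt p (λ t → F (y ∷ᶠ t)) (λ t t′ t≗t′ → ext _ _ (cons-cong t≗t′)))
              (allFin N) ⟩
  ∑ (λ y → ∑ (λ s → ∑ (λ x → F (y ∷ᶠ insertAt s p x)) (allFin N)) (allMaps m N)) (allFin N)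
    ≡⟨ ∑-cong (λ y → ∑-cong (λ s → ∑-cong (λ x → ext _ _ (λ { zero → refl ; (suc j) → refl }))
                                         (allFin N))
                             (allMaps m N))
              (allFin N) ⟩
  ∑ (λ y → ∑ (λ s → G (y ∷ᶠ s)) (allMaps m N)) (allFin N)
    ≡⟨ ∑-allMaps-suc G extG ⟨
  ∑ G (allMaps (suc m) N) ∎
  where
  open ≡-Reasoning
  cons-cong : ∀ {y} {t t′ : Tuple (suc m) N} → t ≗ t′ → (y ∷ᶠ t) ≗ (y ∷ᶠ t′)
  cons-cong t≗t′ zero = refl
  cons-cong t≗t′ (suc i) = t≗t′ i
  G : Tuple (suc m) N → ℤ
  G s = ∑ (λ x → F (insertAt s (suc p) x)) (allFin N)
  extG : TupleExtensional G
  extG s s′ s≗s′ = ∑-cong (λ x → ext _ _ (insertAt-cong s s′ s≗s′ (suc p) x)) (allFin N)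

lineMinusPoly : ℕ → Poly
lineMinusPoly k = (+ 1 - + k) ∷ + 1 ∷ []

planeMinusPoly : ℕ → Poly
planeMinusPoly k = (+ 1 - + k) ∷ + 1 ∷ + 1 ∷ []

eval-lineMinusPoly : ∀ k q → eval (lineMinusPoly k) (+ q) ≡ + suc q - + k
eval-lineMinusPoly k q =
  trans (identity (+ k) (+ q)) (cong (_- + k) (sym (ℤₚ.pos-+ 1 q)))
  where
  identity : ∀ K Q → (+ 1 - K) + Q * (+ 1 + Q * + 0) ≡ (+ 1 + Q) - K
  identity = solve-∀

eval-planeMinusPoly : ∀ k q → eval (planeMinusPoly k) (+ q) ≡ + suc (q ℕ.* suc q) - + k
eval-planeMinusPoly k q =
  trans (identity (+ k) (+ q))
        (cong (_- + k) (sym (trans (ℤₚ.pos-+ 1 (q ℕ.* suc q))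
                                   (cong (λ z → + 1 + z) (trans (ℤₚ.pos-* q (suc q)) (cong (+ q *_) (ℤₚ.pos-+ 1 q)))))))
  where
  identity : ∀ K Q → (+ 1 - K) + Q * (+ 1 + Q * (+ 1 + Q * + 0)) ≡ (+ 1 + Q * (+ 1 + Q)) - K
  identity = solve-∀

+-as-difference : ∀ {a k b} → a ℕ.+ k ≡ b → + a ≡ + b - + k
+-as-difference {a} {k} refl = trans (cancel (+ a) (+ k)) (cong (_- + k) (sym (ℤₚ.pos-+ a k)))
  where
  cancel : ∀ A K → A ≡ (A + K) - K
  cancel = solve-∀

-- When K spans a line of a realization of g, this counts the points of the realization on that line.
pointsOnSpan : ∀ {n} → BoolFun n → Subset n → ℕ
pointsOnSpan {n} g K = count (λ i → g (K [ i ]≔ true)) (allFin n)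

pointsOnSpan-cong : ∀ {n} {g g′ : BoolFun n} → (∀ S → g S ≡ g′ S) → ∀ K → pointsOnSpan g K ≡ pointsOnSpan g′ K
pointsOnSpan-cong {n} g≗g′ K = count-cong (λ i → g≗g′ (K [ i ]≔ true)) (allFin n)

isLSF-cong : ∀ {n} → Extensional (isLSF {n})
isLSF-cong {n} g g′ g≗g′ = all-cong (λ I → all-cong (λ J →
  cong₃ (λ a b c → a ∧ b ∧ c)
        (cong₂ (λ a b → not ((J ⊆ˢ I) ∧ a) ∨ b) (g≗g′ I) (g≗g′ J))
        (cong (not (∣ I ∣ ≤ᵇ 2) ∨_) (g≗g′ I))
        (cong₃ (λ a b c → not (a ∧ b ∧ (2 ≤ᵇ ∣ I ∩ J ∣)) ∨ c) (g≗g′ I) (g≗g′ J) (g≗g′ (I ∪ J))))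
  (allSubsets n)) (allSubsets n)

≤ᶠ-cong : ∀ {n} (f : BoolFun n) → Extensional (f ≤ᶠ_)
≤ᶠ-cong {n} f g g′ g≗g′ = all-cong (λ S → cong (not (f S) ∨_) (g≗g′ S)) (allSubsets n)

isLSF⇒downward-closed : ∀ {n} (f : BoolFun n) → isLSF f ≡ true → ∀ I J → (J ⊆ˢ I) ≡ true → f I ≡ true → f J ≡ true
isLSF⇒downward-closed {n} f lsf I J J⊆I fI =
  not-∨-elim (∧-trueˡ (all-true⇒ _ _ (all-true⇒ _ _ lsf (allSubsets-complete I)) (allSubsets-complete J)))
             (∧-true J⊆I fI)

module Deletion {m : ℕ} (f : BoolFun (suc m)) (p : Fin (suc m)) where

  restriction : BoolFun m
  restriction S = f (Vec.insertAt S p false)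

  fullLinesThroughP : List (Subset (suc m))
  fullLinesThroughP = filterᵇ (λ S → isFullLine f S ∧ lookup S p) (allSubsets (suc m))

  rest : Subset (suc m) → Subset m
  rest L = removeAt L p

  lookup-rest : ∀ S i → lookup (rest S) i ≡ lookup S (punchIn p i)
  lookup-rest S i = trans (sym (Vecₚ.insertAt-punchIn (rest S) p (lookup S p) i))
                          (cong (λ T → lookup T (punchIn p i)) (Vecₚ.insertAt-removeAt S p))

  insertAt-rest : ∀ {b} S → lookup S p ≡ b → Vec.insertAt (rest S) p b ≡ S
  insertAt-rest S refl = Vecₚ.insertAt-removeAt S p

  -- The number of admissible positions for the point p, by the number of full lines through p.
  extensionPoly : List (Subset (suc m)) → BoolFun m → Poly
  extensionPoly [] g = planeMinusPoly m
  extensionPoly (L ∷ []) g = lineMinusPoly (pointsOnSpan g (rest L))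
  extensionPoly (L₁ ∷ L₂ ∷ []) g =
    if g (rest L₁ ∪ rest L₂) then lineMinusPoly (pointsOnSpan g (rest L₁ ∪ rest L₂))
    else if any (λ i → g (rest L₁ [ i ]≔ true) ∧ g (rest L₂ [ i ]≔ true)) (allFin m) then []
    else + 1 ∷ []
  extensionPoly (_ ∷ _ ∷ _ ∷ _) g = []

  coefficient : BoolFun m → Poly
  coefficient g = if restriction ≤ᶠ g then extensionPoly fullLinesThroughP g else []

  extensionPoly-cong : ∀ Ls {g g′} → (∀ S → g S ≡ g′ S) → extensionPoly Ls g ≡ extensionPoly Ls g′
  extensionPoly-cong [] g≗g′ = refl
  extensionPoly-cong (L ∷ []) g≗g′ = cong lineMinusPoly (pointsOnSpan-cong g≗g′ (rest L))
  extensionPoly-cong (L₁ ∷ L₂ ∷ []) {g} {g′} g≗g′ =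
    cong₃ (λ b k c → if b then lineMinusPoly k else if c then [] else + 1 ∷ [])
          (g≗g′ (rest L₁ ∪ rest L₂)) (pointsOnSpan-cong g≗g′ (rest L₁ ∪ rest L₂))
          (any-cong (λ i → cong₂ _∧_ (g≗g′ _) (g≗g′ _)) (allFin m))
  extensionPoly-cong (_ ∷ _ ∷ _ ∷ _) g≗g′ = refl

  coefficient-cong : Extensional coefficient
  coefficient-cong g g′ g≗g′ =
    cong₂ (λ b P → if b then P else [])
          (≤ᶠ-cong restriction g g′ g≗g′)
          (extensionPoly-cong fullLinesThroughP g≗g′)

  ∈-fullLinesThroughP⁻ : ∀ {L} → L ∈ fullLinesThroughP → isFullLine f L ≡ true × lookup L p ≡ true
  ∈-fullLinesThroughP⁻ L∈ = let e = proj₂ (∈-filterᵇ⁻ _ (allSubsets (suc m)) L∈) in ∧-trueˡ e , ∧-trueʳ e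

  isFullLine⇒f : ∀ {L} → isFullLine f L ≡ true → f L ≡ true
  isFullLine⇒f {L} full = ∧-trueˡ (∧-trueʳ {3 ≤ᵇ ∣ L ∣} full)

  -- The fuel k makes the recursion structural: ∣ S ∣ grows strictly and never exceeds suc m.
  contained-in-full-line : ∀ S → f S ≡ true → lookup S p ≡ true → 3 ≤ ∣ S ∣ →
    ∃[ L ] (L ∈ fullLinesThroughP × S ⊑ L)
  contained-in-full-line S = grow (suc m) S (ℕₚ.m≤n+m (suc m) ∣ S ∣)
    where
    grow : ∀ k S → suc m ≤ ∣ S ∣ ℕ.+ k → f S ≡ true → lookup S p ≡ true → 3 ≤ ∣ S ∣ →
      ∃[ L ] (L ∈ fullLinesThroughP × S ⊑ L)
    grow k S bound fS p∈S 3≤∣S∣ with all (λ T → not (S ⊂ˢ T) ∨ not (f T)) (allSubsets (suc m)) in maximal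
    ... | true = S , ∈-filterᵇ⁺ _ _ (allSubsets-complete S) (∧-true (∧-true (≤⇒≤ᵇ≡true 3≤∣S∣) (∧-true fS maximal)) p∈S)
                   , λ _ e → e
    ... | false with all-false⇒ _ (allSubsets (suc m)) maximal
    ... | (T , _ , e) = step k bound
      where
      not∨not≡false⇒ : ∀ {a b} → not a ∨ not b ≡ false → a ≡ true × b ≡ true
      not∨not≡false⇒ {true} {true} _ = refl , refl
      S⊂T : (S ⊂ˢ T) ≡ true
      S⊂T = proj₁ (not∨not≡false⇒ {S ⊂ˢ T} e)
      S⊑T : S ⊑ T
      S⊑T = ⊆ˢ⇒⊑ S T (∧-trueˡ S⊂T)
      ∣S∣<∣T∣ : ∣ S ∣ < ∣ T ∣
      ∣S∣<∣T∣ = ⊂ˢ⇒∣∣< S T S⊂T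
      step : ∀ k → suc m ≤ ∣ S ∣ ℕ.+ k → ∃[ L ] (L ∈ fullLinesThroughP × S ⊑ L)
      step zero bound = ⊥-elim (ℕₚ.<-irrefl refl
        (ℕₚ.≤-trans (ℕₚ.≤-trans (s≤s (subst (suc m ≤_) (ℕₚ.+-identityʳ _) bound)) ∣S∣<∣T∣) (∣p∣≤n T)))
      step (suc k) bound =
        let bound′ = ℕₚ.≤-trans bound (ℕₚ.≤-trans (ℕₚ.≤-reflexive (ℕₚ.+-suc ∣ S ∣ k)) (ℕₚ.+-monoˡ-≤ k ∣S∣<∣T∣))
            (L , L∈ , T⊑L) = grow k T bound′ (proj₂ (not∨not≡false⇒ {S ⊂ˢ T} e)) (S⊑T p p∈S)
                                  (ℕₚ.≤-trans 3≤∣S∣ (ℕₚ.<⇒≤ ∣S∣<∣T∣))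
        in L , L∈ , λ i → T⊑L i ∘ S⊑T i

module Plane {q : ℕ} (Π : ProjectivePlane q) where

  Point Line : Set
  Point = Fin (nPoints Π)
  Line = Fin (nLines Π)

  _on_ : Point → Line → Set
  x on ℓ = incident Π x ℓ ≡ true

  Collinear : ∀ {n} → Tuple n (nPoints Π) → Subset n → Set
  Collinear t S = ∃[ ℓ ] (∀ i → lookup S i ≡ true → t i on ℓ)

  collinearᵇ⇒ : ∀ {n} (t : Tuple n (nPoints Π)) S → collinearᵇ Π t S ≡ true → Collinear t S
  collinearᵇ⇒ {n} t S e =
    let (ℓ , _ , on-ℓ) = any-true⇒ _ (allFin (nLines Π)) e
    in ℓ , λ i → not-∨-elim (all-true⇒ _ (allFin n) on-ℓ (∈-allFin i))

  collinearᵇ⇐ : ∀ {n} (t : Tuple n (nPoints Π)) S → Collinear t S → collinearᵇ Π t S ≡ true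
  collinearᵇ⇐ {n} t S (ℓ , on-ℓ) =
    any-true⇐ _ (allFin (nLines Π)) (∈-allFin ℓ) (all-true⇐ _ (allFin n) (λ {i} _ → not-∨-intro (on-ℓ i)))

  Collinear-⊑ : ∀ {n} (t : Tuple n (nPoints Π)) I J → J ⊑ I → Collinear t I → Collinear t J
  Collinear-⊑ t I J J⊑I (ℓ , on-ℓ) = ℓ , λ i j∈J → on-ℓ i (J⊑I i j∈J)

  line-unique : ∀ {x y ℓ₁ ℓ₂} → x ≢ y → x on ℓ₁ → y on ℓ₁ → x on ℓ₂ → y on ℓ₂ → ℓ₁ ≡ ℓ₂
  line-unique {x} {y} x≢y x₁ y₁ x₂ y₂ =
    let (_ , _ , _ , unique) = lineThrough Π x y x≢y in trans (unique _ x₁ y₁) (sym (unique _ x₂ y₂))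

  line-through-two : ∀ x y → ∃[ ℓ ] (x on ℓ × y on ℓ)
  line-through-two x y with x Fin.≟ y
  ... | no x≢y = let (ℓ , x-on , y-on , _) = lineThrough Π x y x≢y in ℓ , x-on , y-on
  ... | yes refl =
    let (ℓ , _ , x-on) = count>0⇒ (incident Π x) (allFin (nLines Π)) (subst (0 <_) (sym (pointLines Π x)) (s≤s z≤n))
    in ℓ , x-on , x-on

  point₀ : Point
  point₀ = proj₁ (quadrangle Π) zero

  -- Double counting of the pairs (x, ℓ) with x ≠ point₀ and x, point₀ on ℓ.
  nPoints≡ : nPoints Π ≡ suc (q ℕ.* suc q)
  nPoints≡ = begin
    nPoints Π                                   ≡⟨ count-allFin-true (nPoints Π) ⟨
    count (λ _ → true) (allFin (nPoints Π))     ≡⟨ count-delete (λ _ → true) point₀ ⟨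
    others ℕ.+ 1                                ≡⟨ ℕₚ.+-comm others 1 ⟩
    suc others                                  ≡⟨ cong suc (ℤₚ.+-injective (trans (sym by-points) by-lines)) ⟩
    suc (q ℕ.* suc q)                           ∎
    where
    open ≡-Reasoning
    Points : List Point
    Points = allFin (nPoints Π)
    Lines : List Line
    Lines = allFin (nLines Π)
    others : ℕ
    others = count (delete (λ _ → true) point₀) Points
    pairs : Point → Line → ℤ
    pairs x ℓ = boolToℤ (not ⌊ point₀ Fin.≟ x ⌋ ∧ (incident Π point₀ ℓ ∧ incident Π x ℓ))
    one-line-each : ∀ x → ∑ (pairs x) Lines ≡ boolToℤ (not ⌊ point₀ Fin.≟ x ⌋)
    one-line-each x with point₀ Fin.≟ x
    ... | yes _ = ∑-zero _ Lines (λ _ → refl)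
    ... | no point₀≢x =
      let (ℓ₀ , on₀ , on-x , unique) = lineThrough Π point₀ x point₀≢x
      in trans (sym (count-as-∑ (λ ℓ → incident Π point₀ ℓ ∧ incident Π x ℓ) Lines))
               (cong +_ (count-unique _ ℓ₀ (∧-true on₀ on-x) (λ ℓ e → unique ℓ (∧-trueˡ e) (∧-trueʳ {incident Π point₀ ℓ} e))))
    q-others-each : ∀ ℓ → ∑ (λ x → pairs x ℓ) Points ≡ + q * boolToℤ (incident Π point₀ ℓ)
    q-others-each ℓ with incident Π point₀ ℓ in on₀
    ... | false = trans (∑-zero _ Points (λ x → cong boolToℤ (Boolₚ.∧-zeroʳ _))) (sym (ℤₚ.*-zeroʳ (+ q)))
    ... | true = begin
      ∑ (λ x → boolToℤ (not ⌊ point₀ Fin.≟ x ⌋ ∧ incident Π x ℓ)) Points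
        ≡⟨ count-as-∑ _ Points ⟨
      + count (λ x → not ⌊ point₀ Fin.≟ x ⌋ ∧ incident Π x ℓ) Points
        ≡⟨ cong +_ (count-cong (λ x → Boolₚ.∧-comm (not ⌊ point₀ Fin.≟ x ⌋) (incident Π x ℓ)) Points) ⟩
      + count (delete (λ x → incident Π x ℓ) point₀) Points
        ≡⟨ cong +_ (ℕₚ.suc-injective (trans (sym (count-suc-delete _ point₀ on₀)) (linePoints Π ℓ))) ⟩
      + q
        ≡⟨ ℤₚ.*-identityʳ (+ q) ⟨
      + q * + 1 ∎
    by-points : ∑ (λ x → ∑ (pairs x) Lines) Points ≡ + others
    by-points = trans (∑-cong one-line-each Points) (sym (count-as-∑ _ Points))
    by-lines : ∑ (λ x → ∑ (pairs x) Lines) Points ≡ + (q ℕ.* suc q)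
    by-lines = begin
      ∑ (λ x → ∑ (pairs x) Lines) Points                      ≡⟨ ∑-comm pairs Points Lines ⟩
      ∑ (λ ℓ → ∑ (λ x → pairs x ℓ) Points) Lines              ≡⟨ ∑-cong q-others-each Lines ⟩
      ∑ (λ ℓ → + q * boolToℤ (incident Π point₀ ℓ)) Lines     ≡⟨ *-distribˡ-∑ (+ q) _ Lines ⟨
      + q * ∑ (boolToℤ ∘ incident Π point₀) Lines             ≡⟨ cong (+ q *_) (count-as-∑ _ Lines) ⟨
      + q * + count (incident Π point₀) Lines                 ≡⟨ cong (λ c → + q * + c) (pointLines Π point₀) ⟩
      + q * + suc q                                           ≡⟨ ℤₚ.pos-* q (suc q) ⟨
      + (q ℕ.* suc q)                                         ∎

  distinctᵇ⇒injective : ∀ {n} (t : Tuple n (nPoints Π)) → distinctᵇ Π t ≡ true → Injective _≡_ _≡_ t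
  distinctᵇ⇒injective {n} t e {i} {j} tᵢ≡tⱼ =
    ⌊⌋≡true⇒ (i Fin.≟ j) (∨-not-elim (all-true⇒ _ _ (all-true⇒ _ _ e (∈-allFin i)) (∈-allFin j))
                                      (⌊⌋≡true⇐ (t i Fin.≟ t j) tᵢ≡tⱼ))
    where
    ∨-not-elim : ∀ {a b} → a ∨ not b ≡ true → b ≡ true → a ≡ true
    ∨-not-elim {true} _ _ = refl
    ∨-not-elim {false} {true} () _

  injective⇒distinctᵇ : ∀ {n} (t : Tuple n (nPoints Π)) → Injective _≡_ _≡_ t → distinctᵇ Π t ≡ true
  injective⇒distinctᵇ {n} t inj = all-true⇐ _ (allFin n) (λ {i} _ → all-true⇐ _ (allFin n) (λ {j} _ → distinct-pair i j))
    where
    distinct-pair : ∀ i j → ⌊ i Fin.≟ j ⌋ ∨ not ⌊ t i Fin.≟ t j ⌋ ≡ true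
    distinct-pair i j with i Fin.≟ j
    ... | yes _ = refl
    ... | no i≢j = ≡false⇒not≡true (⌊⌋≡false⇐ (t i Fin.≟ t j) (i≢j ∘ inj))

  distinctᵇ-cong : ∀ {n} {t t′ : Tuple n (nPoints Π)} → t ≗ t′ → distinctᵇ Π t ≡ distinctᵇ Π t′
  distinctᵇ-cong {n} t≗t′ =
    all-cong (λ i → all-cong (λ j → cong₂ (λ u v → ⌊ i Fin.≟ j ⌋ ∨ not ⌊ u Fin.≟ v ⌋) (t≗t′ i) (t≗t′ j))
                             (allFin n))
             (allFin n)

  collinearᵇ-cong : ∀ {n} {t t′ : Tuple n (nPoints Π)} → t ≗ t′ → ∀ S → collinearᵇ Π t S ≡ collinearᵇ Π t′ S
  collinearᵇ-cong {n} t≗t′ S =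
    any-cong (λ ℓ → all-cong (λ i → cong (λ x → not (lookup S i) ∨ incident Π x ℓ) (t≗t′ i)) (allFin n)) (allFin (nLines Π))

  small⇒collinear : ∀ {n} (t : Tuple n (nPoints Π)) I → ∣ I ∣ ≤ 2 → Collinear t I
  small⇒collinear {n} t I ∣I∣≤2 with count≤2⇒covered-by-two (lookup I) (subst (_≤ 2) (∣∣≡count I) ∣I∣≤2)
  ... | inj₁ empty = proj₁ (line-through-two point₀ point₀) , λ i i∈I → ⊥-elim (true≢false (trans (sym i∈I) (empty i)))
  ... | inj₂ (a , b , covered) =
    let (ℓ , a-on , b-on) = line-through-two (t a) (t b)
    in ℓ , λ i i∈I → [ (λ { refl → a-on }) , (λ { refl → b-on }) ] (covered i i∈I)

  ∪-collinear : ∀ {n} (t : Tuple n (nPoints Π)) → Injective _≡_ _≡_ t → ∀ I J →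
    Collinear t I → Collinear t J → 2 ≤ ∣ I ∩ J ∣ → Collinear t (I ∪ J)
  ∪-collinear t inj I J (ℓ₁ , on₁) (ℓ₂ , on₂) 2≤∣I∩J∣ = ℓ₁ , on-ℓ₁
    where
    ℓ₁≡ℓ₂ : ℓ₁ ≡ ℓ₂
    ℓ₁≡ℓ₂ with count≥2⇒two-distinct (lookup (I ∩ J)) (subst (2 ≤_) (∣∣≡count (I ∩ J)) 2≤∣I∩J∣)
    ... | (a , b , a≢b , a∈I∩J , b∈I∩J) =
      let (a∈I , a∈J) = ∈-∩⁻ I J a a∈I∩J
          (b∈I , b∈J) = ∈-∩⁻ I J b b∈I∩J
      in line-unique (a≢b ∘ inj) (on₁ a a∈I) (on₁ b b∈I) (on₂ a a∈J) (on₂ b b∈J)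
    on-ℓ₁ : ∀ i → lookup (I ∪ J) i ≡ true → t i on ℓ₁
    on-ℓ₁ i i∈I∪J = [ on₁ i , subst (t i on_) (sym ℓ₁≡ℓ₂) ∘ on₂ i ] (∈-∪⁻ I J i i∈I∪J)

  collinearᵇ-isLSF : ∀ {n} (t : Tuple n (nPoints Π)) → Injective _≡_ _≡_ t → isLSF (collinearᵇ Π t) ≡ true
  collinearᵇ-isLSF {n} t inj =
    all-true⇐ _ (allSubsets n) (λ {I} _ → all-true⇐ _ (allSubsets n) (λ {J} _ →
      ∧-true (not-∨-intro (downward I J)) (∧-true (not-∨-intro (small I)) (not-∨-intro (union I J)))))
    where
    col : BoolFun n
    col = collinearᵇ Π t
    downward : ∀ I J → (J ⊆ˢ I) ∧ col I ≡ true → col J ≡ true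
    downward I J e = collinearᵇ⇐ t J (Collinear-⊑ t I J (⊆ˢ⇒⊑ J I (∧-trueˡ e)) (collinearᵇ⇒ t I (∧-trueʳ {J ⊆ˢ I} e)))
    small : ∀ I → (∣ I ∣ ≤ᵇ 2) ≡ true → col I ≡ true
    small I e = collinearᵇ⇐ t I (small⇒collinear t I (≤ᵇ≡true⇒≤ e))
    union : ∀ I J → col I ∧ col J ∧ (2 ≤ᵇ ∣ I ∩ J ∣) ≡ true → col (I ∪ J) ≡ true
    union I J e =
      collinearᵇ⇐ t (I ∪ J) (∪-collinear t inj I J (collinearᵇ⇒ t I (∧-trueˡ e)) (collinearᵇ⇒ t J (∧-trueˡ (∧-trueʳ {col I} e)))
                                          (≤ᵇ≡true⇒≤ (∧-trueʳ {col J} (∧-trueʳ {col I} e))))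

  ∑-over-realizations : ∀ {n} (Q : BoolFun n → Bool) (u : BoolFun n → ℤ) → Extensional Q → Extensional u →
    ∑ (λ g → u g * + A Π g) (filterᵇ Q (allBoolFuns n)) ≡
    ∑ (λ t → if distinctᵇ Π t ∧ Q (collinearᵇ Π t) then u (collinearᵇ Π t) else + 0) (allMaps n (nPoints Π))
  ∑-over-realizations {n} Q u Q-ext u-ext = begin
    ∑ (λ g → u g * + A Π g) (filterᵇ Q Funs)
      ≡⟨ ∑-filterᵇ _ Q Funs ⟩
    ∑ (λ g → if Q g then u g * + A Π g else + 0) Funs
      ≡⟨ ∑-cong count-realizations Funs ⟩
    ∑ (λ g → ∑ (term g) Tuples) Funs
      ≡⟨ ∑-comm term Funs Tuples ⟩
    ∑ (λ t → ∑ (λ g → term g t) Funs) Tuples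
      ≡⟨ ∑-cong realizes-only-its-collinearity Tuples ⟩
    ∑ (λ t → if distinctᵇ Π t ∧ Q (collinearᵇ Π t) then u (collinearᵇ Π t) else + 0) Tuples ∎
    where
    open ≡-Reasoning
    Funs : List (BoolFun n)
    Funs = allBoolFuns n
    Tuples : List (Tuple n (nPoints Π))
    Tuples = allMaps n (nPoints Π)
    term : BoolFun n → Tuple n (nPoints Π) → ℤ
    term g t = if Q g then u g * boolToℤ (strongRealizationᵇ Π g t) else + 0
    count-realizations : ∀ g → (if Q g then u g * + A Π g else + 0) ≡ ∑ (term g) Tuples
    count-realizations g with Q g
    ... | true = trans (cong (u g *_) (count-as-∑ (strongRealizationᵇ Π g) Tuples)) (*-distribˡ-∑ (u g) _ Tuples)
    ... | false = sym (∑-zero _ Tuples (λ _ → refl))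
    realizes-only-its-collinearity : ∀ t →
      ∑ (λ g → term g t) Funs ≡ (if distinctᵇ Π t ∧ Q (collinearᵇ Π t) then u (collinearᵇ Π t) else + 0)
    realizes-only-its-collinearity t with distinctᵇ Π t
    ... | false = ∑-zero _ Funs (λ g → times-zero (Q g) (u g))
      where
      times-zero : ∀ b z → (if b then z * + 0 else + 0) ≡ + 0
      times-zero true z = ℤₚ.*-zeroʳ z
      times-zero false z = refl
    ... | true = trans (∑-cong as-agreement Funs)
                       (∑-funsOn-agreeing (allSubsets n) (allSubsets-unique n) (collinearᵇ Π t) W W-dep)
      where
      W : BoolFun n → ℤ
      W g = if Q g then u g else + 0
      as-agreement : ∀ g → (if Q g then u g * boolToℤ (agreeOn (allSubsets n) g (collinearᵇ Π t)) else + 0)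
                           ≡ (if agreeOn (allSubsets n) g (collinearᵇ Π t) then W g else + 0)
      as-agreement g with Q g | agreeOn (allSubsets n) g (collinearᵇ Π t)
      ... | true | true = ℤₚ.*-identityʳ (u g)
      ... | true | false = ℤₚ.*-zeroʳ (u g)
      ... | false | true = refl
      ... | false | false = refl
      W-dep : DependsOnlyOn (allSubsets n) W
      W-dep g g′ agree = let g≗g′ = λ S → agree S (allSubsets-complete S)
                         in cong₂ (λ b z → if b then z else + 0) (Q-ext g g′ g≗g′) (u-ext g g′ g≗g′)

  ≤ᶠ-collinearᵇ⇒ : ∀ {n} (g : BoolFun n) t → (g ≤ᶠ collinearᵇ Π t) ≡ true → ∀ S → g S ≡ true → Collinear t S
  ≤ᶠ-collinearᵇ⇒ {n} g t g≤ S gS = collinearᵇ⇒ t S (not-∨-elim (all-true⇒ _ (allSubsets n) g≤ (allSubsets-complete S)) gS)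

  ≤ᶠ-collinearᵇ⇐ : ∀ {n} (g : BoolFun n) t → (∀ S → g S ≡ true → Collinear t S) → (g ≤ᶠ collinearᵇ Π t) ≡ true
  ≤ᶠ-collinearᵇ⇐ {n} g t col = all-true⇐ _ (allSubsets n) (λ {S} _ → not-∨-intro (collinearᵇ⇐ t S ∘ col S))

  record Span {n} (s : Tuple n (nPoints Π)) (K : Subset n) : Set where
    field
      line : Line
      on-line : ∀ i → lookup K i ≡ true → s i on line
      a b : Fin n
      a≢b : a ≢ b
      a∈K : lookup K a ≡ true
      b∈K : lookup K b ≡ true

  span-unique : ∀ {n} {s : Tuple n (nPoints Π)} {K} → Injective _≡_ _≡_ s → (σ : Span s K) →
    ∀ ℓ → (∀ i → lookup K i ≡ true → s i on ℓ) → ℓ ≡ Span.line σ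
  span-unique inj σ ℓ on-ℓ = line-unique (a≢b ∘ inj) (on-ℓ a a∈K) (on-ℓ b b∈K) (on-line a a∈K) (on-line b b∈K)
    where open Span σ

  collinearᵇ-add≡on-span : ∀ {n} {s : Tuple n (nPoints Π)} {K} → Injective _≡_ _≡_ s → (σ : Span s K) →
    ∀ i → collinearᵇ Π s (K [ i ]≔ true) ≡ incident Π (s i) (Span.line σ)
  collinearᵇ-add≡on-span {s = s} {K} inj σ i = ≡true-ext added⇒on on⇒added
    where
    open Span σ
    added⇒on : collinearᵇ Π s (K [ i ]≔ true) ≡ true → s i on line
    added⇒on e =
      let (ℓ , on-ℓ) = collinearᵇ⇒ s (K [ i ]≔ true) e
      in subst (s i on_) (span-unique inj σ ℓ (λ j j∈K → on-ℓ j ([]≔true-keeps K i j j∈K))) (on-ℓ i ([]≔true-self K i))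
    on⇒added : s i on line → collinearᵇ Π s (K [ i ]≔ true) ≡ true
    on⇒added sᵢ-on = collinearᵇ⇐ s (K [ i ]≔ true) (line , λ j e → [ (λ { refl → sᵢ-on }) , on-line j ] ([]≔true⁻ K i j e))

  count-fresh-on-span : ∀ {n} {s : Tuple n (nPoints Π)} {K} → Injective _≡_ _≡_ s → (σ : Span s K) →
    + count (λ x → incident Π x (Span.line σ) ∧ notInImage s x) (allFin (nPoints Π))
      ≡ eval (lineMinusPoly (pointsOnSpan (collinearᵇ Π s) K)) (+ q)
  count-fresh-on-span {n} {s} {K} inj σ =
    trans (+-as-difference (begin
      count (λ x → incident Π x line ∧ notInImage s x) (allFin (nPoints Π)) ℕ.+ pointsOnSpan (collinearᵇ Π s) K
        ≡⟨ cong (count (λ x → incident Π x line ∧ notInImage s x) (allFin (nPoints Π)) ℕ.+_)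
                (count-cong (collinearᵇ-add≡on-span inj σ) (allFin n)) ⟩
      count (λ x → incident Π x line ∧ notInImage s x) (allFin (nPoints Π)) ℕ.+ count (λ i → incident Π (s i) line) (allFin n)
        ≡⟨ count-outside-image s inj (λ x → incident Π x line) ⟩
      count (λ x → incident Π x line) (allFin (nPoints Π))
        ≡⟨ linePoints Π line ⟩
      suc q ∎))
      (sym (eval-lineMinusPoly (pointsOnSpan (collinearᵇ Π s) K) q))
    where
    open ≡-Reasoning
    open Span σ

module Extension {m : ℕ} (f : BoolFun (suc m)) (p : Fin (suc m)) (lsf : isLSF f ≡ true)
                  {q : ℕ} (Π : ProjectivePlane q) where
  open Deletion f p
  open Plane Π

  extend : Tuple m (nPoints Π) → Point → Tuple (suc m) (nPoints Π)
  extend s x = insertAt s p x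

  Valid : Tuple m (nPoints Π) → Point → Bool
  Valid s x = distinctᵇ Π (extend s x) ∧ (f ≤ᶠ collinearᵇ Π (extend s x))

  RealizesRestriction : Tuple m (nPoints Π) → Set
  RealizesRestriction s = ∀ S → restriction S ≡ true → Collinear s S

  extend-injective⁻ : ∀ s x → Injective _≡_ _≡_ (extend s x) → Injective _≡_ _≡_ s × (∀ i → s i ≢ x)
  extend-injective⁻ s x inj =
    (λ {i} {j} sᵢ≡sⱼ → Finₚ.punchIn-injective p i j
                          (inj (trans (Functionalₚ.insertAt-punchIn s p x i)
                                      (trans sᵢ≡sⱼ (sym (Functionalₚ.insertAt-punchIn s p x j)))))) ,
    (λ i sᵢ≡x → Finₚ.punchInᵢ≢i p i (inj (trans (Functionalₚ.insertAt-punchIn s p x i)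
                                                (trans sᵢ≡x (sym (Functionalₚ.insertAt-lookup s p x))))))

  extend-injective⁺ : ∀ s x → Injective _≡_ _≡_ s → (∀ i → s i ≢ x) → Injective _≡_ _≡_ (extend s x)
  extend-injective⁺ s x inj fresh {j} {k} eq with ≡-or-punchIn p j | ≡-or-punchIn p k
  ... | inj₁ refl | inj₁ refl = refl
  ... | inj₁ refl | inj₂ (k′ , refl) =
    ⊥-elim (fresh k′ (trans (sym (Functionalₚ.insertAt-punchIn s p x k′)) (trans (sym eq) (Functionalₚ.insertAt-lookup s p x))))
  ... | inj₂ (j′ , refl) | inj₁ refl =
    ⊥-elim (fresh j′ (trans (sym (Functionalₚ.insertAt-punchIn s p x j′)) (trans eq (Functionalₚ.insertAt-lookup s p x))))
  ... | inj₂ (j′ , refl) | inj₂ (k′ , refl) =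
    cong (punchIn p) (inj (trans (sym (Functionalₚ.insertAt-punchIn s p x j′)) (trans eq (Functionalₚ.insertAt-punchIn s p x k′))))

  f-collinear : Tuple (suc m) (nPoints Π) → Set
  f-collinear t = ∀ S → f S ≡ true → Collinear t S

  restriction-collinear : ∀ s x → f-collinear (extend s x) → RealizesRestriction s
  restriction-collinear s x col S fS =
    let (ℓ , on-ℓ) = col (Vec.insertAt S p false) fS
    in ℓ , λ i i∈S → subst (_on ℓ) (Functionalₚ.insertAt-punchIn s p x i)
                           (on-ℓ (punchIn p i) (trans (Vecₚ.insertAt-punchIn S p false i) i∈S))

  collinear-avoiding-p : ∀ s x → RealizesRestriction s → ∀ S → f S ≡ true → lookup S p ≡ false →
    Collinear (extend s x) S
  collinear-avoiding-p s x real S fS p∉S = extend-line (real (rest S) (subst (λ T → f T ≡ true) (sym (insertAt-rest S p∉S)) fS))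
    where
    extend-line : Collinear s (rest S) → Collinear (extend s x) S
    extend-line (ℓ , on-ℓ) = ℓ , on
      where
      on : ∀ j → lookup S j ≡ true → extend s x j on ℓ
      on j j∈S with ≡-or-punchIn p j
      ... | inj₁ refl = ⊥-elim (true≢false (trans (sym j∈S) p∉S))
      ... | inj₂ (i , refl) = subst (_on ℓ) (sym (Functionalₚ.insertAt-punchIn s p x i))
                                    (on-ℓ i (trans (lookup-rest S i) j∈S))

  collinear-from-full-lines : ∀ s x → RealizesRestriction s →
    (∀ L → L ∈ fullLinesThroughP → Collinear (extend s x) L) → f-collinear (extend s x)
  collinear-from-full-lines s x real full S fS with lookup S p in p∈S
  ... | false = collinear-avoiding-p s x real S fS p∈S
  ... | true with ∣ S ∣ ℕₚ.≤? 2
  ...   | yes small = small⇒collinear _ S small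
  ...   | no big = let (L , L∈ , S⊑L) = contained-in-full-line S fS p∈S (ℕₚ.≰⇒> big)
                   in Collinear-⊑ (extend s x) L S S⊑L (full L L∈)

  valid≡fresh∧full-lines-collinear : ∀ s → Injective _≡_ _≡_ s → RealizesRestriction s → ∀ x →
    Valid s x ≡ notInImage s x ∧ all (collinearᵇ Π (extend s x)) fullLinesThroughP
  valid≡fresh∧full-lines-collinear s inj real x = ≡true-ext valid⇒ valid⇐
    where
    valid⇒ : Valid s x ≡ true → notInImage s x ∧ all (collinearᵇ Π (extend s x)) fullLinesThroughP ≡ true
    valid⇒ e =
      ∧-true (notInImage-true⇐ s x (proj₂ (extend-injective⁻ s x (distinctᵇ⇒injective _ (∧-trueˡ e)))))
             (all-true⇐ _ fullLinesThroughP (λ {L} L∈ →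
               collinearᵇ⇐ _ L (≤ᶠ-collinearᵇ⇒ f _ (∧-trueʳ {distinctᵇ Π (extend s x)} e) L
                                 (isFullLine⇒f (proj₁ (∈-fullLinesThroughP⁻ L∈))))))
    valid⇐ : notInImage s x ∧ all (collinearᵇ Π (extend s x)) fullLinesThroughP ≡ true → Valid s x ≡ true
    valid⇐ e =
      ∧-true (injective⇒distinctᵇ _ (extend-injective⁺ s x inj (notInImage-true⇒ s x (∧-trueˡ e))))
             (≤ᶠ-collinearᵇ⇐ f _ (collinear-from-full-lines s x real (λ L L∈ →
               collinearᵇ⇒ _ L (all-true⇒ _ fullLinesThroughP (∧-trueʳ {notInImage s x} e) L∈))))

  span-of-full-line : ∀ s → RealizesRestriction s → ∀ {L} → L ∈ fullLinesThroughP → Span s (rest L)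
  span-of-full-line s real {L} L∈ =
    span (count≥2⇒two-distinct (lookup (rest L)) (subst (2 ≤_) (∣∣≡count (rest L)) 2≤∣rest∣))
    where
    full : isFullLine f L ≡ true
    full = proj₁ (∈-fullLinesThroughP⁻ L∈)
    L≡ : Vec.insertAt (rest L) p true ≡ L
    L≡ = insertAt-rest L (proj₂ (∈-fullLinesThroughP⁻ L∈))
    restriction-rest : restriction (rest L) ≡ true
    restriction-rest = isLSF⇒downward-closed f lsf L _
      (subst (λ T → (Vec.insertAt (rest L) p false ⊆ˢ T) ≡ true) L≡ (insertAt-outside⊆ˢinside (rest L) p))
      (isFullLine⇒f full)
    2≤∣rest∣ : 2 ≤ ∣ rest L ∣
    2≤∣rest∣ = ℕ.s≤s⁻¹ (subst (3 ≤_) (trans (cong ∣_∣ (sym L≡)) (∣insertAt-inside∣ (rest L) p)) (≤ᵇ≡true⇒≤ (∧-trueˡ full)))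
    span : ∃[ a ] ∃[ b ] (a ≢ b × lookup (rest L) a ≡ true × lookup (rest L) b ≡ true) → Span s (rest L)
    span (a , b , a≢b , a∈K , b∈K) = record
      { line = proj₁ (real (rest L) restriction-rest) ; on-line = proj₂ (real (rest L) restriction-rest)
      ; a = a ; b = b ; a≢b = a≢b ; a∈K = a∈K ; b∈K = b∈K }

  extend-collinear⇒on-span : ∀ s → Injective _≡_ _≡_ s → ∀ {L} → lookup L p ≡ true → (σ : Span s (rest L)) →
    ∀ x → Collinear (extend s x) L → x on Span.line σ
  extend-collinear⇒on-span s inj {L} p∈L σ x (ℓ , on-ℓ) =
    subst (x on_) (span-unique inj σ ℓ rest-on-ℓ) (subst (_on ℓ) (Functionalₚ.insertAt-lookup s p x) (on-ℓ p p∈L))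
    where
    rest-on-ℓ : ∀ i → lookup (rest L) i ≡ true → s i on ℓ
    rest-on-ℓ i e = subst (_on ℓ) (Functionalₚ.insertAt-punchIn s p x i) (on-ℓ (punchIn p i) (trans (sym (lookup-rest L i)) e))

  on-span⇒extend-collinear : ∀ s {L} → (σ : Span s (rest L)) → ∀ x → x on Span.line σ → Collinear (extend s x) L
  on-span⇒extend-collinear s {L} σ x x-on = line , on
    where
    open Span σ
    on : ∀ j → lookup L j ≡ true → extend s x j on line
    on j j∈L with ≡-or-punchIn p j
    ... | inj₁ refl = subst (_on line) (sym (Functionalₚ.insertAt-lookup s p x)) x-on
    ... | inj₂ (i , refl) = subst (_on line) (sym (Functionalₚ.insertAt-punchIn s p x i)) (on-line i (trans (lookup-rest L i) j∈L))

  extend-collinearᵇ≡on-span : ∀ s → Injective _≡_ _≡_ s → (real : RealizesRestriction s) →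
    ∀ {L} (L∈ : L ∈ fullLinesThroughP) →
    ∀ x → collinearᵇ Π (extend s x) L ≡ incident Π x (Span.line (span-of-full-line s real L∈))
  extend-collinearᵇ≡on-span s inj real {L} L∈ x = ≡true-ext
    (extend-collinear⇒on-span s inj {L} (proj₂ (∈-fullLinesThroughP⁻ L∈)) σ x ∘ collinearᵇ⇒ (extend s x) L)
    (collinearᵇ⇐ (extend s x) L ∘ on-span⇒extend-collinear s {L} σ x)
    where σ = span-of-full-line s real L∈

  extensionCount : Tuple m (nPoints Π) → List (Subset (suc m)) → ℕ
  extensionCount s Ls = count (λ x → notInImage s x ∧ all (collinearᵇ Π (extend s x)) Ls) (allFin (nPoints Π))

  extensionCount-none : ∀ s → Injective _≡_ _≡_ s → + extensionCount s [] ≡ eval (planeMinusPoly m) (+ q)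
  extensionCount-none s inj = trans (+-as-difference (begin
    extensionCount s [] ℕ.+ m
      ≡⟨ cong₂ ℕ._+_ (count-cong (Boolₚ.∧-identityʳ ∘ notInImage s) (allFin (nPoints Π))) (sym (count-allFin-true m)) ⟩
    count (notInImage s) (allFin (nPoints Π)) ℕ.+ count (λ _ → true) (allFin m)
      ≡⟨ count-outside-image s inj (λ _ → true) ⟩
    count (λ _ → true) (allFin (nPoints Π))
      ≡⟨ count-allFin-true (nPoints Π) ⟩
    nPoints Π
      ≡⟨ nPoints≡ ⟩
    suc (q ℕ.* suc q) ∎)) (sym (eval-planeMinusPoly m q))
    where open ≡-Reasoning

  extensionCount-one : ∀ s → Injective _≡_ _≡_ s → RealizesRestriction s → ∀ {L} → L ∈ fullLinesThroughP →
    + extensionCount s (L ∷ []) ≡ eval (lineMinusPoly (pointsOnSpan (collinearᵇ Π s) (rest L))) (+ q)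
  extensionCount-one s inj real {L} L∈ =
    trans (cong +_ (count-cong on-span (allFin (nPoints Π)))) (count-fresh-on-span inj (span-of-full-line s real L∈))
    where
    on-span : ∀ x → notInImage s x ∧ (collinearᵇ Π (extend s x) L ∧ true)
                    ≡ incident Π x (Span.line (span-of-full-line s real L∈)) ∧ notInImage s x
    on-span x = trans (cong (λ b → notInImage s x ∧ b) (trans (Boolₚ.∧-identityʳ _) (extend-collinearᵇ≡on-span s inj real L∈ x)))
                      (Boolₚ.∧-comm (notInImage s x) _)

  extensionCount-common-span : ∀ s → Injective _≡_ _≡_ s → RealizesRestriction s → ∀ {L₁ L₂} →
    L₁ ∈ fullLinesThroughP → L₂ ∈ fullLinesThroughP → collinearᵇ Π s (rest L₁ ∪ rest L₂) ≡ true →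
    + extensionCount s (L₁ ∷ L₂ ∷ []) ≡ eval (lineMinusPoly (pointsOnSpan (collinearᵇ Π s) (rest L₁ ∪ rest L₂))) (+ q)
  extensionCount-common-span s inj real {L₁} {L₂} L₁∈ L₂∈ union =
    trans (cong +_ (count-cong on-common (allFin (nPoints Π)))) (count-fresh-on-span inj σ)
    where
    σ₁ : Span s (rest L₁)
    σ₁ = span-of-full-line s real L₁∈
    σ₂ : Span s (rest L₂)
    σ₂ = span-of-full-line s real L₂∈
    common : Collinear s (rest L₁ ∪ rest L₂)
    common = collinearᵇ⇒ s (rest L₁ ∪ rest L₂) union
    ℓ : Line
    ℓ = proj₁ common
    line₁≡ℓ : Span.line σ₁ ≡ ℓ
    line₁≡ℓ = sym (span-unique inj σ₁ ℓ (λ i → proj₂ common i ∘ ⊑-∪ˡ (rest L₁) (rest L₂) i))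
    line₂≡ℓ : Span.line σ₂ ≡ ℓ
    line₂≡ℓ = sym (span-unique inj σ₂ ℓ (λ i → proj₂ common i ∘ ⊑-∪ʳ (rest L₁) (rest L₂) i))
    σ : Span s (rest L₁ ∪ rest L₂)
    σ = record { line = ℓ ; on-line = proj₂ common ; a = Span.a σ₁ ; b = Span.b σ₁ ; a≢b = Span.a≢b σ₁
               ; a∈K = ⊑-∪ˡ (rest L₁) (rest L₂) _ (Span.a∈K σ₁) ; b∈K = ⊑-∪ˡ (rest L₁) (rest L₂) _ (Span.b∈K σ₁) }
    on-common : ∀ x → notInImage s x ∧ (collinearᵇ Π (extend s x) L₁ ∧ (collinearᵇ Π (extend s x) L₂ ∧ true))
                      ≡ incident Π x ℓ ∧ notInImage s x
    on-common x =
      trans (cong₂ (λ b c → notInImage s x ∧ (b ∧ (c ∧ true)))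
                   (trans (extend-collinearᵇ≡on-span s inj real L₁∈ x) (cong (incident Π x) line₁≡ℓ))
                   (trans (extend-collinearᵇ≡on-span s inj real L₂∈ x) (cong (incident Π x) line₂≡ℓ)))
            (absorb (notInImage s x) (incident Π x ℓ))
      where
      absorb : ∀ a b → a ∧ (b ∧ (b ∧ true)) ≡ b ∧ a
      absorb a false = Boolₚ.∧-zeroʳ a
      absorb a true = Boolₚ.∧-identityʳ a

  extensionCount-meeting-spans : ∀ s → Injective _≡_ _≡_ s → RealizesRestriction s → ∀ {L₁ L₂} →
    L₁ ∈ fullLinesThroughP → L₂ ∈ fullLinesThroughP → collinearᵇ Π s (rest L₁ ∪ rest L₂) ≡ false →
    + extensionCount s (L₁ ∷ L₂ ∷ [])
      ≡ eval (if any (λ i → collinearᵇ Π s (rest L₁ [ i ]≔ true) ∧ collinearᵇ Π s (rest L₂ [ i ]≔ true)) (allFin m)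
              then [] else + 1 ∷ []) (+ q)
  extensionCount-meeting-spans s inj real {L₁} {L₂} L₁∈ L₂∈ not-common =
    trans (cong +_ (trans (count-cong at-meet (allFin (nPoints Π))) (count-single meet (notInImage s)))) meet-fresh
    where
    σ₁ : Span s (rest L₁)
    σ₁ = span-of-full-line s real L₁∈
    σ₂ : Span s (rest L₂)
    σ₂ = span-of-full-line s real L₂∈
    ℓ₁ ℓ₂ : Line
    ℓ₁ = Span.line σ₁
    ℓ₂ = Span.line σ₂
    ℓ₁≢ℓ₂ : ℓ₁ ≢ ℓ₂
    ℓ₁≢ℓ₂ ℓ₁≡ℓ₂ = true≢false (trans (sym (collinearᵇ⇐ s (rest L₁ ∪ rest L₂) (ℓ₁ , on-ℓ₁))) not-common)
      where
      on-ℓ₁ : ∀ i → lookup (rest L₁ ∪ rest L₂) i ≡ true → s i on ℓ₁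
      on-ℓ₁ i e = [ Span.on-line σ₁ i , subst (s i on_) (sym ℓ₁≡ℓ₂) ∘ Span.on-line σ₂ i ] (∈-∪⁻ (rest L₁) (rest L₂) i e)
    meeting : ∃[ x ] (x on ℓ₁ × x on ℓ₂ × (∀ x′ → x′ on ℓ₁ → x′ on ℓ₂ → x′ ≡ x))
    meeting = meetPoint Π ℓ₁ ℓ₂ ℓ₁≢ℓ₂
    meet : Point
    meet = proj₁ meeting
    on-both≡meet : ∀ x → incident Π x ℓ₁ ∧ incident Π x ℓ₂ ≡ ⌊ meet Fin.≟ x ⌋
    on-both≡meet x = ≡true-ext
      (λ e → ⌊⌋≡true⇐ (meet Fin.≟ x) (sym (proj₂ (proj₂ (proj₂ meeting)) x (∧-trueˡ e) (∧-trueʳ {incident Π x ℓ₁} e))))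
      (λ e → subst (λ z → incident Π z ℓ₁ ∧ incident Π z ℓ₂ ≡ true) (⌊⌋≡true⇒ (meet Fin.≟ x) e)
                   (∧-true (proj₁ (proj₂ meeting)) (proj₁ (proj₂ (proj₂ meeting)))))
    at-meet : ∀ x → notInImage s x ∧ (collinearᵇ Π (extend s x) L₁ ∧ (collinearᵇ Π (extend s x) L₂ ∧ true))
                    ≡ ⌊ meet Fin.≟ x ⌋ ∧ notInImage s x
    at-meet x =
      trans (cong₂ (λ b c → notInImage s x ∧ (b ∧ (c ∧ true)))
                   (extend-collinearᵇ≡on-span s inj real L₁∈ x) (extend-collinearᵇ≡on-span s inj real L₂∈ x))
            (trans (cong (notInImage s x ∧_) (trans (cong (incident Π x ℓ₁ ∧_) (Boolₚ.∧-identityʳ _)) (on-both≡meet x)))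
                   (Boolₚ.∧-comm (notInImage s x) _))
    spans-meet-at : ∀ i → collinearᵇ Π s (rest L₁ [ i ]≔ true) ∧ collinearᵇ Π s (rest L₂ [ i ]≔ true)
                          ≡ ⌊ s i Fin.≟ meet ⌋
    spans-meet-at i = trans (cong₂ _∧_ (collinearᵇ-add≡on-span inj σ₁ i) (collinearᵇ-add≡on-span inj σ₂ i))
                            (trans (on-both≡meet (s i)) (⌊≟⌋-sym meet (s i)))
    meet-fresh : boolToℤ (notInImage s meet)
      ≡ eval (if any (λ i → collinearᵇ Π s (rest L₁ [ i ]≔ true) ∧ collinearᵇ Π s (rest L₂ [ i ]≔ true)) (allFin m)
              then [] else + 1 ∷ []) (+ q)
    meet-fresh = trans (cong boolToℤ (trans (all-cong (λ i → cong not (sym (spans-meet-at i))) (allFin m))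
                                            (all-not≡not-any _ (allFin m))))
                       (fresh-unless _)
      where
      fresh-unless : ∀ b → boolToℤ (not b) ≡ eval (if b then [] else + 1 ∷ []) (+ q)
      fresh-unless true = refl
      fresh-unless false = sym (cong (λ z → + 1 + z) (ℤₚ.*-zeroʳ (+ q)))

  extensionCount≡eval : ∀ s → Injective _≡_ _≡_ s → RealizesRestriction s →
    ∀ Ls → (∀ {L} → L ∈ Ls → L ∈ fullLinesThroughP) → length Ls ≤ 2 →
    + extensionCount s Ls ≡ eval (extensionPoly Ls (collinearᵇ Π s)) (+ q)
  extensionCount≡eval s inj real [] _ _ = extensionCount-none s inj
  extensionCount≡eval s inj real (L ∷ []) ⊆FL _ = extensionCount-one s inj real (⊆FL (here refl))
  extensionCount≡eval s inj real (L₁ ∷ L₂ ∷ []) ⊆FL _ with collinearᵇ Π s (rest L₁ ∪ rest L₂) in union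
  ... | true = extensionCount-common-span s inj real (⊆FL (here refl)) (⊆FL (there (here refl))) union
  ... | false = extensionCount-meeting-spans s inj real (⊆FL (here refl)) (⊆FL (there (here refl))) union
  extensionCount≡eval s inj real (_ ∷ _ ∷ _ ∷ _) _ (s≤s (s≤s ()))

  count-valid : length fullLinesThroughP ≤ 2 → ∀ s →
    + count (Valid s) (allFin (nPoints Π))
      ≡ (if distinctᵇ Π s ∧ isLSF (collinearᵇ Π s) then eval (coefficient (collinearᵇ Π s)) (+ q) else + 0)
  count-valid few-lines s with distinctᵇ Π s in distinct
  ... | false = cong +_ (count-none (Valid s) (allFin (nPoints Π)) (λ x → Boolₚ.¬-not (λ valid →
                  true≢false (trans (sym (injective⇒distinctᵇ s (proj₁ (extend-injective⁻ s x
                                     (distinctᵇ⇒injective _ (∧-trueˡ valid)))))) distinct))))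
  ... | true rewrite collinearᵇ-isLSF s (distinctᵇ⇒injective s distinct) with restriction ≤ᶠ collinearᵇ Π s in realizes
  ...   | false = cong +_ (count-none (Valid s) (allFin (nPoints Π)) (λ x → Boolₚ.¬-not (λ valid →
                    true≢false (trans (sym (≤ᶠ-collinearᵇ⇐ restriction s
                                              (restriction-collinear s x (≤ᶠ-collinearᵇ⇒ f _ (∧-trueʳ {distinctᵇ Π (extend s x)} valid)))))
                                      realizes))))
  ...   | true =
    trans (cong +_ (count-cong (valid≡fresh∧full-lines-collinear s inj real) (allFin (nPoints Π))))
          (extensionCount≡eval s inj real fullLinesThroughP (λ L∈ → L∈) few-lines)
    where
    inj : Injective _≡_ _≡_ s
    inj = distinctᵇ⇒injective s distinct
    real : RealizesRestriction s
    real = ≤ᶠ-collinearᵇ⇒ restriction s realizes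

if-then-1-else-0 : ∀ b → (if b then + 1 else + 0) ≡ boolToℤ b
if-then-1-else-0 true = refl
if-then-1-else-0 false = refl

B≡∑-realized : ∀ {n q} (Π : ProjectivePlane q) (f : BoolFun n) →
  + B Π f ≡ ∑ (λ t → if distinctᵇ Π t ∧ (f ≤ᶠ collinearᵇ Π t) then + 1 else + 0) (allMaps n (nPoints Π))
B≡∑-realized {n} Π f = begin
  + B Π f
    ≡⟨ sum-as-∑ (A Π) (filterᵇ (f ≤ᶠ_) (allBoolFuns n)) ⟩
  ∑ (λ g → + A Π g) (filterᵇ (f ≤ᶠ_) (allBoolFuns n))
    ≡⟨ ∑-cong (λ g → sym (ℤₚ.*-identityˡ (+ A Π g))) (filterᵇ (f ≤ᶠ_) (allBoolFuns n)) ⟩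
  ∑ (λ g → + 1 * + A Π g) (filterᵇ (f ≤ᶠ_) (allBoolFuns n))
    ≡⟨ Plane.∑-over-realizations Π (f ≤ᶠ_) (λ _ → + 1) (≤ᶠ-cong f) (λ _ _ _ → refl) ⟩
  ∑ (λ t → if distinctᵇ Π t ∧ (f ≤ᶠ collinearᵇ Π t) then + 1 else + 0) (allMaps n (nPoints Π)) ∎
  where open ≡-Reasoning

B≡∑-coefficient*A : ∀ {m} (f : BoolFun (suc m)) p → isLSF f ≡ true → index f p ≤ 2 → ∀ {q} (Π : ProjectivePlane q) →
  + B Π f ≡ ∑ (λ g → eval (Deletion.coefficient f p g) (+ q) * + A Π g) (filterᵇ isLSF (allBoolFuns m))
B≡∑-coefficient*A {m} f p lsf few-lines {q} Π = begin
  + B Π f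
    ≡⟨ B≡∑-realized Π f ⟩
  ∑ realized (allMaps (suc m) (nPoints Π))
    ≡⟨ ∑-allMaps-insertAt p realized realized-cong ⟩
  ∑ (λ s → ∑ (λ x → realized (extend s x)) (allFin (nPoints Π))) (allMaps m (nPoints Π))
    ≡⟨ ∑-cong count-extensions (allMaps m (nPoints Π)) ⟩
  ∑ (λ s → if distinctᵇ Π s ∧ isLSF (collinearᵇ Π s) then eval (coefficient (collinearᵇ Π s)) (+ q) else + 0)
    (allMaps m (nPoints Π))
    ≡⟨ ∑-over-realizations {m} isLSF (λ g → eval (coefficient g) (+ q)) isLSF-cong
                           (λ g g′ g≗g′ → cong (λ P → eval P (+ q)) (coefficient-cong g g′ g≗g′)) ⟨
  ∑ (λ g → eval (coefficient g) (+ q) * + A Π g) (filterᵇ isLSF (allBoolFuns m)) ∎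
  where
  open ≡-Reasoning
  open Plane Π
  open Deletion f p
  open Extension f p lsf Π
  realized : Tuple (suc m) (nPoints Π) → ℤ
  realized t = if distinctᵇ Π t ∧ (f ≤ᶠ collinearᵇ Π t) then + 1 else + 0
  realized-cong : TupleExtensional realized
  realized-cong t t′ t≗t′ =
    cong₂ (λ d c → if d ∧ c then + 1 else + 0) (distinctᵇ-cong t≗t′)
          (all-cong (λ S → cong (not (f S) ∨_) (collinearᵇ-cong t≗t′ S)) (allSubsets (suc m)))
  count-extensions : ∀ s → ∑ (λ x → realized (extend s x)) (allFin (nPoints Π))
    ≡ (if distinctᵇ Π s ∧ isLSF (collinearᵇ Π s) then eval (coefficient (collinearᵇ Π s)) (+ q) else + 0)
  count-extensions s = begin
    ∑ (λ x → realized (extend s x)) (allFin (nPoints Π)) ≡⟨ ∑-cong (if-then-1-else-0 ∘ Valid s) (allFin (nPoints Π)) ⟩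
    ∑ (boolToℤ ∘ Valid s) (allFin (nPoints Π))           ≡⟨ count-as-∑ (Valid s) (allFin (nPoints Π)) ⟨
    + count (Valid s) (allFin (nPoints Π))               ≡⟨ count-valid few-lines s ⟩
    _                                                    ∎

lemma2p1 : (n : ℕ) → 2 ≤ n → (f : BoolFun n) → isLSF f ≡ true
    → ∃[ p ] (index f p ≤ 2)
    → Σ Poly λ p₀ → Σ (BoolFun (n ∸ 1) → Poly) λ pg →
        ∀ (q : ℕ) (Π : ProjectivePlane q) →
          + B Π f ≡ eval p₀ (+ q)
                    + sumℤ (map (λ g → eval (pg g) (+ q) * + A Π g)
                                (filterᵇ isLSF (allBoolFuns (n ∸ 1))))
lemma2p1 (suc m) _ f lsf (p , few-lines) =
  [] , Deletion.coefficient f p ,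
  λ q Π → trans (B≡∑-coefficient*A f p lsf few-lines Π) (sym (ℤₚ.+-identityˡ _))
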